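{- For $n\ge 1$ let $$E_n(x,y,z)=\sum_{\pi\in \mathcal{D}_n^B}x^{\mathrm{wexc}(\pi)}y^{\mathrm{aexc}(\pi)}z^{\mathrm{single}(\pi)}.$$ Define integers $g_n(i,j)$ ($n\ge1$, $i,j\in\mathbb{Z}$) by $g_1(1,0)=1$, $g_1(i,j)=0$ for $(i,j)\neq(1,0)$, and $$g_{n+1}(i,j)=g_n(i-1,j)+4(1+i)g_n(i+1,j-1)+2j\, g_n(i,j)+4(n+2-i-2j)g_n(i,j-1).$$ Then the $g_n(i,j)$ are nonnegative integers and, for $n\ge1$, $$E_n(x,y,z)=\sum_{i=0}^n z^{i}\sum_{j=0}^{\lfloor (n-i)/2\rfloor}g_n(i,j)(xy)^{j}(x+y)^{n-i-2j};$$ in particular $E_n(x,y,z)$ is a partial $\gamma$-positive polynomial (the coefficient of each $z^i$ is $\gamma$-positive).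
   Context: $B_n$ is the hyperoctahedral group: bijections $\pi$ of $\pm[n]=\{\pm1,\dots,\pm n\}$ with $\pi(-i)=-\pi(i)$. A fixed point of $\pi$ is $i\in[n]$ with $\pi(i)=i$; $\mathcal{D}_n^B$ is the set of $\pi\in B_n$ with no fixed points. For $\pi\in\mathcal D_n^B$: $\mathrm{wexc}(\pi)=\#\{i\in[n]:\pi(|\pi(i)|)>\pi(i)\}$, $\mathrm{aexc}(\pi)=\#\{i\in[n]:\pi(|\pi(i)|)<\pi(i)\}$, and $\mathrm{single}(\pi)=\#\{i\in[n]:\pi(i)=-i\}$. A symmetric polynomial $f(x)$ of degree $\le m$ is $\gamma$-positive if $f(x)=\sum_k \gamma_k x^k(1+x)^{m-2k}$ with all $\gamma_k\ge0$; a polynomial in $x,y,z$ expanded as $\sum_i z^i\sum_j c_{i,j}(xy)^j(x+y)^{m_i-2j}$ with $c_{i,j}\ge 0$ is called partial $\gamma$-positive. -}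

module Defs where

open import Data.Nat as ℕ using (ℕ; zero; suc; _∸_)
open import Data.Nat.DivMod using (_/_)
open import Data.Integer as ℤ using (ℤ; +_; -_; _+_; _*_; _^_; ∣_∣)
open import Data.Bool using (Bool; true; false; _∧_; not; if_then_else_)
open import Data.List as List using (List; []; _∷_; map; concatMap; filter; upTo; length; foldr)
open import Data.Vec as Vec using (Vec; []; _∷_; toList)
open import Relation.Nullary.Decidable using (⌊_⌋)
open import Data.Product using (_×_; _,_)

-- Signed permutations of [n], represented by the vector
-- (π(1), …, π(n)) ∈ (±[n])ⁿ.  An element of B_n is determined by these
-- values (π(-i) = -π(i)), and such a vector comes from an element of B_n
-- iff its entries lie in ±[n] and |π(1)|, …, |π(n)| are pairwise distinct.

signedVals : ℕ → List ℤ
signedVals n = map (λ k → + suc k) (upTo n) List.++ map (λ k → - (+ suc k)) (upTo n)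

allVecs : (n m : ℕ) → List (Vec ℤ m)
allVecs n zero    = [] ∷ []
allVecs n (suc m) = concatMap (λ a → map (a ∷_) (allVecs n m)) (signedVals n)

allB : ∀ {A : Set} → (A → Bool) → List A → Bool
allB p = foldr (λ a b → p a ∧ b) true

sumℤ : List ℤ → ℤ
sumℤ = foldr _+_ (+ 0)

distinct : List ℕ → Bool
distinct []       = true
distinct (a ∷ as) = allB (λ b → not ⌊ a ℕ.≟ b ⌋) as ∧ distinct as

Bn : (n : ℕ) → List (Vec ℤ n)
Bn n = filter (λ v → distinct (map ∣_∣ (toList v)) Data.Bool.≟ true) (allVecs n n)
  where import Data.Bool

-- π(k) for k ∈ [n] (k is 1-based); value 0 outside [n] (never used)
ev : ∀ {n} → Vec ℤ n → ℕ → ℤ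
ev []       k             = + 0
ev (a ∷ v)  zero          = + 0
ev (a ∷ v)  (suc zero)    = a
ev (a ∷ v)  (suc (suc k)) = ev v (suc k)

graph : ∀ {n} → Vec ℤ n → List (ℕ × ℤ)
graph {n} v = map (λ k → suc k , ev v (suc k)) (upTo n)

count : ∀ {A : Set} → (A → Bool) → List A → ℕ
count p xs = length (filter (λ a → p a Data.Bool.≟ true) xs)
  where import Data.Bool

fixedPointFree : ∀ {n} → Vec ℤ n → Bool
fixedPointFree v = allB (λ { (i , p) → not ⌊ p ℤ.≟ + i ⌋ }) (graph v)

DB : (n : ℕ) → List (Vec ℤ n)
DB n = filter (λ v → fixedPointFree v Data.Bool.≟ true) (Bn n)
  where import Data.Bool

wexc : ∀ {n} → Vec ℤ n → ℕ
wexc v = count (λ { (i , p) → ⌊ p ℤ.<? ev v ∣ p ∣ ⌋ }) (graph v)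

aexc : ∀ {n} → Vec ℤ n → ℕ
aexc v = count (λ { (i , p) → ⌊ ev v ∣ p ∣ ℤ.<? p ⌋ }) (graph v)

single : ∀ {n} → Vec ℤ n → ℕ
single v = count (λ { (i , p) → ⌊ p ℤ.≟ - (+ i) ⌋ }) (graph v)

E : ℕ → ℤ → ℤ → ℤ → ℤ
E n x y z = sumℤ (map (λ π → (x ^ wexc π) * (y ^ aexc π) * (z ^ single π)) (DB n))

-- g_n(i,j).  gaux k i j = g_{k+1}(i,j).

gaux : ℕ → ℤ → ℤ → ℤ
gaux zero i j = if ⌊ i ℤ.≟ + 1 ⌋ ∧ ⌊ j ℤ.≟ + 0 ⌋ then + 1 else + 0
gaux (suc k) i j =
  let n = + suc k in
    gaux k (i ℤ.- + 1) j
  + (+ 4) * (+ 1 + i) * gaux k (i + + 1) (j ℤ.- + 1)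
  + (+ 2) * j * gaux k i j
  + (+ 4) * (n + + 2 ℤ.- i ℤ.- (+ 2) * j) * gaux k i (j ℤ.- + 1)

-- g_n(i,j) for n ≥ 1 (g 0 is never used)
g : ℕ → ℤ → ℤ → ℤ
g zero    i j = + 0
g (suc k) i j = gaux k i j

gammaExpansion : ℕ → ℤ → ℤ → ℤ → ℤ
gammaExpansion n x y z =
  sumℤ (map (λ i → (z ^ i) *
        sumℤ (map (λ j → g n (+ i) (+ j) * ((x * y) ^ j) * ((x + y) ^ (n ∸ i ∸ 2 ℕ.* j)))
                 (upTo (suc ((n ∸ i) / 2)))))
      (upTo (suc n)))

-- Both sides are treated as linear functionals of a test function f on monomials (evaluation at
-- (x, y, z) is one such f), and both satisfy E_{n+1} = T E_n with T = z + 2xy (∂ₓ + ∂ᵧ) + 4xy ∂_z.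
-- For E: a signed derangement σ of [n + 1] either ends with σ(n + 1) = −(n + 1), and removing it
-- leaves a derangement with one single less, or has ±(n + 1) at a position k; writing σ(n + 1)
-- there gives a derangement π of [n], except when σ(n + 1) = k + 1, where −(k + 1) is written.
-- Indexing positions by |π(i)|, every position of π carries exactly one of the labels x, y, z
-- counted by wexc, aexc and single, and inserting ±(n + 1) at a position with label x, y or z
-- multiplies the monomial by y, x or xy/z.
-- For the γ-expansion, T maps z^i (xy)^j (x+y)^m to four terms of the same shape, which after a
-- shift of (i , j) are the four terms of the recurrence for g.  The same recurrence shows that g
-- vanishes unless i, j ≥ 0 and i + 2j ≤ n, where all its coefficients are nonnegative.

module Submission where

open import Defs
open import Data.Nat using (ℕ; _≥_)
open import Data.Integer using (ℤ; +_; _≤_)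
open import Data.Product using (_×_)
open import Relation.Binary.PropositionalEquality using (_≡_)

open import Data.Bool using (Bool; true; false; if_then_else_; not; _∧_)
import Data.Bool as Bool
open import Data.Empty using (⊥-elim)
open import Data.Nat as ℕ using (zero; suc; _∸_; z≤n; s≤s; z<s)
open import Data.Nat.DivMod using (_/_; m/n≤m; m*n/n≡m; /-monoˡ-≤)
import Data.Nat.Properties as ℕP
import Data.Nat.Tactic.RingSolver as ℕSolver
open import Algebra.Properties.CommutativeSemigroup ℕP.+-commutativeSemigroup using (xy∙z≈xz∙y; x∙yz≈y∙xz)
open import Data.Integer using (-[1+_]; _+_; _*_; _-_; -_; ∣_∣; +≤+)
import Data.Integer as ℤ
import Data.Integer.Properties as ℤP
open import Data.Integer.Tactic.RingSolver using (solve-∀)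
open import Data.List using (List; []; _∷_; _++_; map; concatMap; filter; upTo; applyUpTo; length)
import Data.List as List
import Data.List.Properties as ListP
open import Data.List.Membership.DecPropositional ℕ._≟_ using (_∈?_)
open import Data.List.Membership.Propositional.Properties using (∈-∃++)
open import Data.List.Relation.Unary.All as All using (All; []; _∷_)
import Data.List.Relation.Unary.All.Properties as AllP
open import Data.List.Relation.Unary.AllPairs using ([]; _∷_)
open import Data.List.Relation.Unary.Unique.Propositional using (Unique)
import Data.List.Relation.Unary.Unique.Propositional.Properties as UniqueP
open import Data.Product using (_,_; proj₁; proj₂; uncurry; ∃-syntax)
open import Data.Sum using (_⊎_; inj₁; inj₂)
open import Data.Unit using (⊤; tt)
open import Data.Vec using (Vec; []; _∷_; _∷ʳ_; toList)
open import Function using (_∘_; id; case_of_)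
open import Relation.Binary.Definitions using (tri<; tri≈; tri>)
open import Relation.Binary.PropositionalEquality
open import Relation.Nullary using (Dec; yes; no; ¬_)
open import Relation.Nullary.Decidable using (⌊_⌋)

∑ : ∀ {A : Set} → List A → (A → ℤ) → ℤ
∑ l h = sumℤ (map h l)

module _ {A : Set} where

  ∑-cong : ∀ (l : List A) {h h′ : A → ℤ} → (∀ a → h a ≡ h′ a) → ∑ l h ≡ ∑ l h′
  ∑-cong []      eq = refl
  ∑-cong (a ∷ l) eq = cong₂ _+_ (eq a) (∑-cong l eq)

  ∑-zero : ∀ (l : List A) {h : A → ℤ} → (∀ a → h a ≡ + 0) → ∑ l h ≡ + 0
  ∑-zero []      eq = refl
  ∑-zero (a ∷ l) eq = cong₂ _+_ (eq a) (∑-zero l eq)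

  ∑-++ : ∀ (l₁ l₂ : List A) h → ∑ (l₁ ++ l₂) h ≡ ∑ l₁ h + ∑ l₂ h
  ∑-++ []       l₂ h = sym (ℤP.+-identityˡ _)
  ∑-++ (a ∷ l₁) l₂ h = trans (cong (_+_ (h a)) (∑-++ l₁ l₂ h)) (sym (ℤP.+-assoc (h a) _ _))

  ∑-+ : ∀ (l : List A) h h′ → ∑ l (λ a → h a + h′ a) ≡ ∑ l h + ∑ l h′
  ∑-+ []      h h′ = refl
  ∑-+ (a ∷ l) h h′ = trans (cong (_+_ (h a + h′ a)) (∑-+ l h h′)) (interchange (h a) (h′ a) _ _)
    where
    interchange : ∀ x y u v → (x + y) + (u + v) ≡ (x + u) + (y + v)
    interchange = solve-∀

  ∑-*ˡ : ∀ (l : List A) c h → ∑ l (λ a → c * h a) ≡ c * ∑ l h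
  ∑-*ˡ []      c h = sym (ℤP.*-zeroʳ c)
  ∑-*ˡ (a ∷ l) c h = trans (cong (_+_ (c * h a)) (∑-*ˡ l c h)) (sym (ℤP.*-distribˡ-+ c (h a) _))

  ∑-map : ∀ {B : Set} (f : B → A) (l : List B) h → ∑ (map f l) h ≡ ∑ l (h ∘ f)
  ∑-map f []      h = refl
  ∑-map f (b ∷ l) h = cong (_+_ (h (f b))) (∑-map f l h)

  ∑-concatMap : ∀ {B : Set} (f : B → List A) (l : List B) h →
                ∑ (concatMap f l) h ≡ ∑ l (λ b → ∑ (f b) h)
  ∑-concatMap f []      h = refl
  ∑-concatMap f (b ∷ l) h =
    trans (∑-++ (f b) (concatMap f l) h) (cong (_+_ (∑ (f b) h)) (∑-concatMap f l h))

  ∑-filter : ∀ (p : A → Bool) (l : List A) h →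
             ∑ (filter (λ a → p a Bool.≟ true) l) h ≡ ∑ l (λ a → if p a then h a else + 0)
  ∑-filter p []      h = refl
  ∑-filter p (a ∷ l) h with p a
  ... | true  = cong (_+_ (h a)) (∑-filter p l h)
  ... | false = trans (∑-filter p l h) (sym (ℤP.+-identityˡ _))

  ∑-if : ∀ (l : List A) (t : Bool) h →
         ∑ l (λ a → if t then h a else + 0) ≡ (if t then ∑ l h else + 0)
  ∑-if l true  h = refl
  ∑-if l false h = ∑-zero l (λ _ → refl)

∑-swap : ∀ {A B : Set} (l : List A) (l′ : List B) (h : A → B → ℤ) →
         ∑ l (λ a → ∑ l′ (h a)) ≡ ∑ l′ (λ b → ∑ l (λ a → h a b))
∑-swap []      l′ h = sym (∑-zero l′ (λ _ → refl))
∑-swap (a ∷ l) l′ h = trans (cong (_+_ (∑ l′ (h a))) (∑-swap l l′ h)) (sym (∑-+ l′ (h a) _))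

∑-upTo-suc : ∀ n (F : ℕ → ℤ) → ∑ (upTo (suc n)) F ≡ ∑ (upTo n) F + F n
∑-upTo-suc n F = begin
  ∑ (upTo (suc n)) F          ≡⟨ cong (λ l → ∑ l F) (ListP.upTo-∷ʳ n) ⟨
  ∑ (upTo n List.∷ʳ n) F      ≡⟨ ∑-++ (upTo n) (n ∷ []) F ⟩
  ∑ (upTo n) F + (F n + + 0)  ≡⟨ cong (_+_ (∑ (upTo n) F)) (ℤP.+-identityʳ _) ⟩
  ∑ (upTo n) F + F n          ∎
  where open ≡-Reasoning

∑-upTo-suc′ : ∀ n (F : ℕ → ℤ) → ∑ (upTo (suc n)) F ≡ F 0 + ∑ (upTo n) (F ∘ suc)
∑-upTo-suc′ n F =
  cong (_+_ (F 0)) (trans (cong (λ l → ∑ l F) (sym (ListP.map-upTo suc n))) (∑-map suc (upTo n) F))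

∑-upTo-cong : ∀ n {F G : ℕ → ℤ} → (∀ k → k ℕ.< n → F k ≡ G k) → ∑ (upTo n) F ≡ ∑ (upTo n) G
∑-upTo-cong zero    eq = refl
∑-upTo-cong (suc n) {F} {G} eq = begin
  ∑ (upTo (suc n)) F  ≡⟨ ∑-upTo-suc n F ⟩
  ∑ (upTo n) F + F n  ≡⟨ cong₂ _+_ (∑-upTo-cong n (λ k k<n → eq k (ℕP.m<n⇒m<1+n k<n))) (eq n (ℕP.n<1+n n)) ⟩
  ∑ (upTo n) G + G n  ≡⟨ ∑-upTo-suc n G ⟨
  ∑ (upTo (suc n)) G  ∎
  where open ≡-Reasoning

∑-upTo-truncate : ∀ {a b} (F : ℕ → ℤ) → a ℕ.≤ b → (∀ x → a ℕ.≤ x → F x ≡ + 0) →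
                  ∑ (upTo b) F ≡ ∑ (upTo a) F
∑-upTo-truncate {a} {zero}  F z≤n vanish = refl
∑-upTo-truncate {a} {suc b} F a≤1+b vanish with a ℕ.≟ suc b
... | yes refl = refl
... | no a≢1+b = begin
  ∑ (upTo (suc b)) F  ≡⟨ ∑-upTo-suc b F ⟩
  ∑ (upTo b) F + F b  ≡⟨ cong₂ _+_ (∑-upTo-truncate F a≤b vanish) (vanish b a≤b) ⟩
  ∑ (upTo a) F + + 0  ≡⟨ ℤP.+-identityʳ _ ⟩
  ∑ (upTo a) F        ∎
  where
  open ≡-Reasoning
  a≤b : a ℕ.≤ b
  a≤b = ℕP.m<1+n⇒m≤n (ℕP.≤∧≢⇒< a≤1+b a≢1+b)

-- Polynomials as functionals on monomials

-- A polynomial P ∈ ℤ[x,y,z] is handled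
-- through the functional f ↦ ⟨P , f⟩ on test functions f : Monomial → ℤ, so that
-- linear operators on polynomials become their transposes acting on f.
Monomial : Set
Monomial = ℕ × ℕ × ℕ

timesX timesY timesZ divZ : Monomial → Monomial
timesX (a , b , c) = suc a , b , c
timesY (a , b , c) = a , suc b , c
timesZ (a , b , c) = a , b , suc c
divZ   (a , b , c) = a , b , c ∸ 1

evalAt : ℤ → ℤ → ℤ → Monomial → ℤ
evalAt x y z (a , b , c) = (x ℤ.^ a) * (y ℤ.^ b) * (z ℤ.^ c)

-- The transpose of T = z + 2xy (∂ₓ + ∂ᵧ) + 4xy ∂_z.
Tᵀ : (Monomial → ℤ) → Monomial → ℤ
Tᵀ f t@(a , b , c) =
  f (timesZ t) + (+ 2 * + a) * f (timesY t) + (+ 2 * + b) * f (timesX t)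
  + (+ 4 * + c) * f (timesX (timesY (divZ t)))

-- ⟨ z^i (xy)^j (x+y)^m , f ⟩
gammaTerm : ℕ → ℕ → ℕ → (Monomial → ℤ) → ℤ
gammaTerm i j zero    f = f (j , j , i)
gammaTerm i j (suc m) f = gammaTerm i j m (λ t → f (timesX t) + f (timesY t))

gammaTerm-cong : ∀ m i j {f f′ : Monomial → ℤ} → (∀ t → f t ≡ f′ t) →
                 gammaTerm i j m f ≡ gammaTerm i j m f′
gammaTerm-cong zero    i j eq = eq _
gammaTerm-cong (suc m) i j eq = gammaTerm-cong m i j (λ t → cong₂ _+_ (eq (timesX t)) (eq (timesY t)))

gammaTerm-+ : ∀ m i j (f f′ : Monomial → ℤ) →
              gammaTerm i j m (λ t → f t + f′ t) ≡ gammaTerm i j m f + gammaTerm i j m f′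
gammaTerm-+ zero    i j f f′ = refl
gammaTerm-+ (suc m) i j f f′ =
  trans (gammaTerm-cong m i j (λ t → interchange (f (timesX t)) (f′ (timesX t)) (f (timesY t)) (f′ (timesY t))))
        (gammaTerm-+ m i j (λ t → f (timesX t) + f (timesY t)) (λ t → f′ (timesX t) + f′ (timesY t)))
  where
  interchange : ∀ a b c d → (a + b) + (c + d) ≡ (a + c) + (b + d)
  interchange = solve-∀

gammaTerm-*ˡ : ∀ m i j c (f : Monomial → ℤ) → gammaTerm i j m (λ t → c * f t) ≡ c * gammaTerm i j m f
gammaTerm-*ˡ zero    i j c f = refl
gammaTerm-*ˡ (suc m) i j c f =
  trans (gammaTerm-cong m i j (λ t → sym (ℤP.*-distribˡ-+ c (f (timesX t)) (f (timesY t)))))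
        (gammaTerm-*ˡ m i j c (λ t → f (timesX t) + f (timesY t)))

gammaTerm-timesXY : ∀ m i j (f : Monomial → ℤ) →
                    gammaTerm i j m (f ∘ timesX ∘ timesY) ≡ gammaTerm i (suc j) m f
gammaTerm-timesXY zero    i j f = refl
gammaTerm-timesXY (suc m) i j f = gammaTerm-timesXY m i j (λ t → f (timesX t) + f (timesY t))

gammaTerm-evalAt : ∀ m i j x y z →
                   gammaTerm i j m (evalAt x y z) ≡ ((x + y) ℤ.^ m) * evalAt x y z (j , j , i)
gammaTerm-evalAt zero    i j x y z = sym (ℤP.*-identityˡ _)
gammaTerm-evalAt (suc m) i j x y z = begin
  gammaTerm i j m (λ t → evalAt x y z (timesX t) + evalAt x y z (timesY t))
    ≡⟨ gammaTerm-cong m i j (λ (a , b , c) → distrib x y (x ℤ.^ a) (y ℤ.^ b) (z ℤ.^ c)) ⟩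
  gammaTerm i j m (λ t → (x + y) * evalAt x y z t)
    ≡⟨ gammaTerm-*ˡ m i j (x + y) (evalAt x y z) ⟩
  (x + y) * gammaTerm i j m (evalAt x y z)
    ≡⟨ cong ((x + y) *_) (gammaTerm-evalAt m i j x y z) ⟩
  (x + y) * (((x + y) ℤ.^ m) * evalAt x y z (j , j , i))
    ≡⟨ ℤP.*-assoc (x + y) _ _ ⟨
  ((x + y) ℤ.^ suc m) * evalAt x y z (j , j , i) ∎
  where
  open ≡-Reasoning
  distrib : ∀ x y a b c → (x * a) * b * c + a * (y * b) * c ≡ (x + y) * (a * b * c)
  distrib = solve-∀

-- T((x + y) P) = (x + y) T P + 4xy P
Tᵀ-x+y : ∀ (f : Monomial → ℤ) t →
         Tᵀ f (timesX t) + Tᵀ f (timesY t) ≡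
         Tᵀ (λ u → f (timesX u) + f (timesY u)) t + + 4 * f (timesX (timesY t))
Tᵀ-x+y f t@(a , b , c) =
  rearrange (+ a) (+ b) (+ c)
    (f (timesX (timesZ t))) (f (timesY (timesZ t))) (f (timesX (timesY t))) (f (timesY (timesY t)))
    (f (timesX (timesX t))) (f (timesX (timesX (timesY (divZ t))))) (f (timesY (timesX (timesY (divZ t)))))
  where
  rearrange : ∀ a b c p q r s u v w →
    (p + (+ 2 * (+ 1 + a)) * r + (+ 2 * b) * u + (+ 4 * c) * v) +
    (q + (+ 2 * a) * s + (+ 2 * (+ 1 + b)) * r + (+ 4 * c) * w)
    ≡ ((p + q) + (+ 2 * a) * (r + s) + (+ 2 * b) * (u + r) + (+ 4 * c) * (v + w)) + + 4 * r
  rearrange = solve-∀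

gammaTerm-Tᵀ : ∀ m i j (f : Monomial → ℤ) →
  gammaTerm i j m (Tᵀ f) ≡
  gammaTerm (suc i) j m f + (+ 4 * + i) * gammaTerm (i ∸ 1) (suc j) m f
  + (+ 2 * + j) * gammaTerm i j (suc m) f + (+ 4 * + m) * gammaTerm i (suc j) (m ∸ 1) f
gammaTerm-Tᵀ zero i j f =
  rearrange (f (j , j , suc i)) (+ j) (+ i) (f (j , suc j , i)) (f (suc j , j , i))
            (f (suc j , suc j , i ∸ 1)) (gammaTerm i (suc j) 0 f)
  where
  rearrange : ∀ p J I r u v w → p + (+ 2 * J) * r + (+ 2 * J) * u + (+ 4 * I) * v ≡
                                p + (+ 4 * I) * v + (+ 2 * J) * (u + r) + (+ 4 * + 0) * w
  rearrange = solve-∀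
gammaTerm-Tᵀ (suc m) i j f = begin
  gammaTerm i j m (λ t → Tᵀ f (timesX t) + Tᵀ f (timesY t))
    ≡⟨ gammaTerm-cong m i j (Tᵀ-x+y f) ⟩
  gammaTerm i j m (λ t → Tᵀ f′ t + + 4 * f (timesX (timesY t)))
    ≡⟨ gammaTerm-+ m i j (Tᵀ f′) _ ⟩
  gammaTerm i j m (Tᵀ f′) + gammaTerm i j m (λ t → + 4 * f (timesX (timesY t)))
    ≡⟨ cong₂ _+_ (gammaTerm-Tᵀ m i j f′)
                 (trans (gammaTerm-*ˡ m i j (+ 4) (f ∘ timesX ∘ timesY)) (cong (+ 4 *_) (gammaTerm-timesXY m i j f))) ⟩
  (A + B + C + (+ 4 * + m) * gammaTerm i (suc j) (m ∸ 1) f′) + + 4 * gammaTerm i (suc j) m f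
    ≡⟨ shift m ⟩
  A + B + C + (+ 4 * + suc m) * gammaTerm i (suc j) m f ∎
  where
  open ≡-Reasoning
  f′ : Monomial → ℤ
  f′ t = f (timesX t) + f (timesY t)
  A B C : ℤ
  A = gammaTerm (suc i) j (suc m) f
  B = (+ 4 * + i) * gammaTerm (i ∸ 1) (suc j) (suc m) f
  C = (+ 2 * + j) * gammaTerm i j (suc (suc m)) f
  shift : ∀ m → (A + B + C + (+ 4 * + m) * gammaTerm i (suc j) (m ∸ 1) f′) + + 4 * gammaTerm i (suc j) m f
                ≡ A + B + C + (+ 4 * + suc m) * gammaTerm i (suc j) m f
  shift zero    = absorb₀ A B C (gammaTerm i (suc j) 0 f′) (gammaTerm i (suc j) 0 f)
    where
    absorb₀ : ∀ a b c u v → (a + b + c + (+ 4 * + 0) * u) + + 4 * v ≡ a + b + c + (+ 4 * + 1) * v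
    absorb₀ = solve-∀
  shift (suc m) = absorb A B C (+ suc m) (gammaTerm i (suc j) (suc m) f)
    where
    absorb : ∀ a b c M v → (a + b + c + (+ 4 * M) * v) + + 4 * v ≡ a + b + c + (+ 4 * (+ 1 + M)) * v
    absorb = solve-∀

xyDegree : ℕ → ℕ → ℕ → ℕ
xyDegree n i j = n ∸ i ∸ 2 ℕ.* j

xyDegree≡ : ∀ n i j → xyDegree n i j ≡ n ∸ (i ℕ.+ 2 ℕ.* j)
xyDegree≡ n i j = ℕP.∸-+-assoc n i (2 ℕ.* j)

-- Support and nonnegativity of g

OutsideSupport : ℕ → ℤ → ℤ → Set
OutsideSupport k -[1+ _ ] j        = ⊤
OutsideSupport k (+ a)    -[1+ _ ] = ⊤
OutsideSupport k (+ a)    (+ b)    = suc k ℕ.< a ℕ.+ 2 ℕ.* b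

2*suc : ∀ a b → a ℕ.+ 2 ℕ.* suc b ≡ suc (suc (a ℕ.+ 2 ℕ.* b))
2*suc = ℕSolver.solve-∀

coefficient≡xyDegree : ∀ k a b → a ℕ.+ 2 ℕ.* b ℕ.≤ suc k →
                       + suc k + + 2 - + a - + 2 * + suc b ≡ + xyDegree (suc k) a b
coefficient≡xyDegree k a b a+2b≤n = begin
  + n + + 2 - + a - + 2 * (+ 1 + + b)  ≡⟨ cancel₂ (+ n) (+ a) (+ b) ⟩
  + n + - (+ a + + 2 * + b)            ≡⟨ cong (λ t → + n + - (+ a + t)) (ℤP.pos-* 2 b) ⟨
  + n + - + (a ℕ.+ 2 ℕ.* b)            ≡⟨ ℤP.m-n≡m⊖n n (a ℕ.+ 2 ℕ.* b) ⟩
  n ℤ.⊖ (a ℕ.+ 2 ℕ.* b)                ≡⟨ ℤP.⊖-≥ a+2b≤n ⟩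
  + (n ∸ (a ℕ.+ 2 ℕ.* b))              ≡⟨ cong +_ (ℕP.∸-+-assoc n a (2 ℕ.* b)) ⟨
  + xyDegree n a b                     ∎
  where
  open ≡-Reasoning
  n : ℕ
  n = suc k
  cancel₂ : ∀ n a b → n + + 2 - a - + 2 * (+ 1 + b) ≡ n + - (a + + 2 * b)
  cancel₂ = solve-∀

private
  *-zeroʳ-≡ : ∀ c {x} → x ≡ + 0 → c * x ≡ + 0
  *-zeroʳ-≡ c refl = ℤP.*-zeroʳ c

  +-zero-≡ : ∀ {a b c d : ℤ} → a ≡ + 0 → b ≡ + 0 → c ≡ + 0 → d ≡ + 0 → a + b + c + d ≡ + 0
  +-zero-≡ refl refl refl refl = refl

gaux-outside : ∀ k i j → OutsideSupport k i j → gaux k i j ≡ + 0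
gaux-outside zero -[1+ a ]         j         _ = refl
gaux-outside zero (+ 0)            j         _ = refl
gaux-outside zero (+ 1)            -[1+ b ]  _ = refl
gaux-outside zero (+ 1)            (+ suc b) _ = refl
gaux-outside zero (+ 1)            (+ 0)     (s≤s ())
gaux-outside zero (+ suc (suc a))  j         _ = refl
gaux-outside (suc k) i j out =
  +-zero-≡ (gaux-outside k (i - + 1) j (lowerI i j out))
           (lowerJ-shiftI i j out)
           (*-zeroʳ-≡ (+ 2 * j) (gaux-outside k i j (sameIJ i j out)))
           (lowerJ i j out)
  where
  lowerI : ∀ i j → OutsideSupport (suc k) i j → OutsideSupport k (i - + 1) j
  lowerI -[1+ a ]      j         _   = tt
  lowerI (+ 0)         j         _   = tt
  lowerI (+ suc a)     -[1+ b ]  _   = tt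
  lowerI (+ suc a)     (+ b)     out = ℕP.≤-pred out

  sameIJ : ∀ i j → OutsideSupport (suc k) i j → OutsideSupport k i j
  sameIJ -[1+ a ] j        _   = tt
  sameIJ (+ a)    -[1+ b ] _   = tt
  sameIJ (+ a)    (+ b)    out = ℕP.<-trans (ℕP.n<1+n (suc k)) out

  lowerJ-shiftI : ∀ i j → OutsideSupport (suc k) i j →
                  + 4 * (+ 1 + i) * gaux k (i + + 1) (j - + 1) ≡ + 0
  lowerJ-shiftI -[1+ 0 ]     j         _   = ℤP.*-zeroˡ (gaux k (+ 0) (j - + 1))
  lowerJ-shiftI -[1+ suc a ] j         _   = *-zeroʳ-≡ (+ 4 * (+ 1 + -[1+ suc a ])) (gaux-outside k -[1+ a ] (j - + 1) tt)
  lowerJ-shiftI (+ a)        -[1+ b ]  _   = *-zeroʳ-≡ (+ 4 * (+ 1 + + a)) (gaux-outside k (+ a + + 1) (-[1+ b ] - + 1) tt)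
  lowerJ-shiftI (+ a)        (+ 0)     _   = *-zeroʳ-≡ (+ 4 * (+ 1 + + a)) (gaux-outside k (+ a + + 1) -[1+ 0 ] tt)
  lowerJ-shiftI (+ a)        (+ suc b) out = *-zeroʳ-≡ (+ 4 * (+ 1 + + a)) (gaux-outside k (+ (a ℕ.+ 1)) (+ b)
    (ℕP.≤-pred (subst (suc (suc (suc k)) ℕ.≤_) (shift a b) out)))
    where
    shift : ∀ a b → a ℕ.+ 2 ℕ.* suc b ≡ suc ((a ℕ.+ 1) ℕ.+ 2 ℕ.* b)
    shift = ℕSolver.solve-∀

  lowerJ : ∀ i j → OutsideSupport (suc k) i j →
           + 4 * (+ suc k + + 2 - i - + 2 * j) * gaux k i (j - + 1) ≡ + 0
  lowerJ -[1+ a ] j         _   = *-zeroʳ-≡ (+ 4 * (+ suc k + + 2 - -[1+ a ] - + 2 * j)) (gaux-outside k -[1+ a ] (j - + 1) tt)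
  lowerJ (+ a)    -[1+ b ]  _   = *-zeroʳ-≡ (+ 4 * (+ suc k + + 2 - + a - + 2 * -[1+ b ])) (gaux-outside k (+ a) (-[1+ b ] - + 1) tt)
  lowerJ (+ a)    (+ 0)     _   = *-zeroʳ-≡ (+ 4 * (+ suc k + + 2 - + a - + 2 * + 0)) (gaux-outside k (+ a) -[1+ 0 ] tt)
  lowerJ (+ a)    (+ suc b) out with suc k ℕ.<? a ℕ.+ 2 ℕ.* b
  ... | yes outₖ = *-zeroʳ-≡ (+ 4 * (+ suc k + + 2 - + a - + 2 * + suc b)) (gaux-outside k (+ a) (+ b) outₖ)
  ... | no ¬outₖ = begin
    + 4 * (+ suc k + + 2 - + a - + 2 * + suc b) * gaux k (+ a) (+ b)
      ≡⟨ cong (λ c → + 4 * c * gaux k (+ a) (+ b)) (coefficient≡xyDegree k a b a+2b≤n) ⟩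
    + 4 * + xyDegree (suc k) a b * gaux k (+ a) (+ b)
      ≡⟨ cong (λ d → + 4 * + d * gaux k (+ a) (+ b))
              (trans (xyDegree≡ (suc k) a b) (ℕP.m≤n⇒m∸n≡0 (ℕP.≤-reflexive n≡a+2b))) ⟩
    + 4 * + 0 * gaux k (+ a) (+ b)
      ≡⟨ ℤP.*-zeroˡ (gaux k (+ a) (+ b)) ⟩
    + 0 ∎
    where
    open ≡-Reasoning
    a+2b≤n : a ℕ.+ 2 ℕ.* b ℕ.≤ suc k
    a+2b≤n = ℕP.≮⇒≥ ¬outₖ
    n≡a+2b : suc k ≡ a ℕ.+ 2 ℕ.* b
    n≡a+2b = ℕP.≤-antisym (ℕP.≤-pred (ℕP.≤-pred (subst (suc (suc (suc k)) ℕ.≤_) (2*suc a b) out))) a+2b≤n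

private
  0≤-+ : ∀ {x y : ℤ} → + 0 ≤ x → + 0 ≤ y → + 0 ≤ x + y
  0≤-+ {+ m} {+ n} _ _ = +≤+ z≤n

  0≤-* : ∀ {x y : ℤ} → + 0 ≤ x → + 0 ≤ y → + 0 ≤ x * y
  0≤-* {+ m} {+ n} _ _ = subst (+ 0 ≤_) (ℤP.pos-* m n) (+≤+ z≤n)

  0≤+ : ∀ n → + 0 ≤ + n
  0≤+ n = +≤+ z≤n

  ≡0⇒0≤ : ∀ {x} → x ≡ + 0 → + 0 ≤ x
  ≡0⇒0≤ refl = +≤+ z≤n

gaux-nonneg : ∀ k i j → + 0 ≤ gaux k i j
gaux-nonneg zero i j with ⌊ i ℤ.≟ + 1 ⌋ Bool.∧ ⌊ j ℤ.≟ + 0 ⌋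
... | true  = 0≤+ 1
... | false = 0≤+ 0
gaux-nonneg (suc k) -[1+ a ] j        = ≡0⇒0≤ (gaux-outside (suc k) -[1+ a ] j tt)
gaux-nonneg (suc k) (+ a)    -[1+ b ] = ≡0⇒0≤ (gaux-outside (suc k) (+ a) -[1+ b ] tt)
gaux-nonneg (suc k) (+ a)    (+ b)    =
  0≤-+ (0≤-+ (0≤-+ (gaux-nonneg k (+ a - + 1) (+ b))
                   (0≤-* (0≤-* (0≤+ 4) (0≤+ (1 ℕ.+ a))) (gaux-nonneg k (+ a + + 1) (+ b - + 1))))
             (0≤-* (0≤-* (0≤+ 2) (0≤+ b)) (gaux-nonneg k (+ a) (+ b))))
       (lowerJ b)
  where
  lowerJ : ∀ b → + 0 ≤ + 4 * (+ suc k + + 2 - + a - + 2 * + b) * gaux k (+ a) (+ b - + 1)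
  lowerJ zero = ≡0⇒0≤ (*-zeroʳ-≡ (+ 4 * (+ suc k + + 2 - + a - + 2 * + 0)) (gaux-outside k (+ a) -[1+ 0 ] tt))
  lowerJ (suc b) with a ℕ.+ 2 ℕ.* b ℕ.≤? suc k
  ... | yes a+2b≤n = 0≤-* (0≤-* (0≤+ 4) (subst (+ 0 ≤_) (sym (coefficient≡xyDegree k a b a+2b≤n)) (0≤+ _)))
                          (gaux-nonneg k (+ a) (+ b))
  ... | no a+2b≰n  = ≡0⇒0≤ (*-zeroʳ-≡ (+ 4 * (+ suc k + + 2 - + a - + 2 * + suc b))
                                      (gaux-outside k (+ a) (+ b) (ℕP.≰⇒> a+2b≰n)))

-- The γ-expansion satisfies the recurrence of E

xyDegree-suc : ∀ n i j → i ℕ.+ 2 ℕ.* j ℕ.≤ n → xyDegree (suc n) i j ≡ suc (xyDegree n i j)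
xyDegree-suc n i j i+2j≤n =
  trans (xyDegree≡ (suc n) i j) (trans (ℕP.+-∸-assoc 1 i+2j≤n) (cong suc (sym (xyDegree≡ n i j))))

xyDegree-sucʲ≡ : ∀ n i j → xyDegree (suc n) i (suc j) ≡ n ∸ suc (i ℕ.+ 2 ℕ.* j)
xyDegree-sucʲ≡ n i j = trans (xyDegree≡ (suc n) i (suc j)) (cong (suc n ∸_) (2*suc i j))

xyDegree-sucʲ : ∀ n i j → xyDegree (suc n) i (suc j) ≡ xyDegree n (suc i) j
xyDegree-sucʲ n i j = trans (xyDegree-sucʲ≡ n i j) (sym (xyDegree≡ n (suc i) j))

xyDegree-sucʲ′ : ∀ n i j → xyDegree (suc n) i (suc j) ≡ xyDegree n i j ∸ 1
xyDegree-sucʲ′ n i j = begin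
  xyDegree (suc n) i (suc j)    ≡⟨ xyDegree-sucʲ≡ n i j ⟩
  n ∸ suc (i ℕ.+ 2 ℕ.* j)       ≡⟨ cong (n ∸_) (ℕP.+-comm 1 (i ℕ.+ 2 ℕ.* j)) ⟩
  n ∸ (i ℕ.+ 2 ℕ.* j ℕ.+ 1)     ≡⟨ ℕP.∸-+-assoc n (i ℕ.+ 2 ℕ.* j) 1 ⟨
  n ∸ (i ℕ.+ 2 ℕ.* j) ∸ 1       ≡⟨ cong (_∸ 1) (xyDegree≡ n i j) ⟨
  xyDegree n i j ∸ 1            ∎
  where open ≡-Reasoning

∑-upTo-shift : ∀ n (F G : ℕ → ℤ) → F 0 ≡ + 0 → G n ≡ + 0 → (∀ k → F (suc k) ≡ G k) →
               ∑ (upTo (suc n)) F ≡ ∑ (upTo (suc n)) G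
∑-upTo-shift n F G F0≡0 Gn≡0 F∘suc≡G = begin
  ∑ (upTo (suc n)) F            ≡⟨ ∑-upTo-suc′ n F ⟩
  F 0 + ∑ (upTo n) (F ∘ suc)    ≡⟨ cong₂ _+_ F0≡0 (∑-cong (upTo n) F∘suc≡G) ⟩
  + 0 + ∑ (upTo n) G            ≡⟨ ℤP.+-identityˡ _ ⟩
  ∑ (upTo n) G                  ≡⟨ ℤP.+-identityʳ _ ⟨
  ∑ (upTo n) G + + 0            ≡⟨ cong (_+_ (∑ (upTo n) G)) Gn≡0 ⟨
  ∑ (upTo n) G + G n            ≡⟨ ∑-upTo-suc n G ⟨
  ∑ (upTo (suc n)) G            ∎
  where open ≡-Reasoning

∑∑ : ℕ → (ℕ → ℕ → ℤ) → ℤ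
∑∑ R F = ∑ (upTo R) (λ i → ∑ (upTo R) (F i))

∑∑-cong : ∀ R {F G : ℕ → ℕ → ℤ} → (∀ i j → F i j ≡ G i j) → ∑∑ R F ≡ ∑∑ R G
∑∑-cong R eq = ∑-cong (upTo R) (λ i → ∑-cong (upTo R) (eq i))

∑∑-+ : ∀ R (F G : ℕ → ℕ → ℤ) → ∑∑ R (λ i j → F i j + G i j) ≡ ∑∑ R F + ∑∑ R G
∑∑-+ R F G = trans (∑-cong (upTo R) (λ i → ∑-+ (upTo R) (F i) (G i))) (∑-+ (upTo R) _ _)

∑∑-+₄ : ∀ R (F₁ F₂ F₃ F₄ : ℕ → ℕ → ℤ) →
        ∑∑ R (λ i j → F₁ i j + F₂ i j + F₃ i j + F₄ i j) ≡ ∑∑ R F₁ + ∑∑ R F₂ + ∑∑ R F₃ + ∑∑ R F₄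
∑∑-+₄ R F₁ F₂ F₃ F₄ =
  trans (∑∑-+ R _ F₄) (cong (_+ ∑∑ R F₄) (trans (∑∑-+ R _ F₃) (cong (_+ ∑∑ R F₃) (∑∑-+ R F₁ F₂))))

gammaSum : ℕ → ℕ → (Monomial → ℤ) → ℤ
gammaSum n R f = ∑∑ R (λ i j → g n (+ i) (+ j) * gammaTerm i j (xyDegree n i j) f)

gaux-outsideℕ : ∀ k i j → suc k ℕ.< i ℕ.+ 2 ℕ.* j → gaux k (+ i) (+ j) ≡ + 0
gaux-outsideℕ k i j = gaux-outside k (+ i) (+ j)

gammaSum-truncate : ∀ k {R} (f : Monomial → ℤ) → suc (suc k) ℕ.≤ R →
                    gammaSum (suc k) R f ≡ gammaSum (suc k) (suc (suc k)) f
gammaSum-truncate k {R} f n<R =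
  trans (∑-cong (upTo R) (λ i → ∑-upTo-truncate (term i) n<R (λ j n<j → vanish i j (ℕP.≤-trans n<j (j≤i+2j i j)))))
        (∑-upTo-truncate (λ i → ∑ (upTo (suc (suc k))) (term i)) n<R
          (λ i n<i → ∑-zero (upTo (suc (suc k))) (λ j → vanish i j (ℕP.≤-trans n<i (ℕP.m≤m+n i _)))))
  where
  term : ℕ → ℕ → ℤ
  term i j = gaux k (+ i) (+ j) * gammaTerm i j (xyDegree (suc k) i j) f
  j≤i+2j : ∀ i j → j ℕ.≤ i ℕ.+ 2 ℕ.* j
  j≤i+2j i j = ℕP.≤-trans (ℕP.m≤m+n j (j ℕ.+ 0)) (ℕP.m≤n+m (2 ℕ.* j) i)
  vanish : ∀ i j → suc k ℕ.< i ℕ.+ 2 ℕ.* j → term i j ≡ + 0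
  vanish i j out = trans (cong (_* gammaTerm i j (xyDegree (suc k) i j) f) (gaux-outsideℕ k i j out))
                         (ℤP.*-zeroˡ (gammaTerm i j (xyDegree (suc k) i j) f))

module _ (k : ℕ) (f : Monomial → ℤ) where

  open ≡-Reasoning

  private
    n R : ℕ
    n = suc k
    R = suc (suc n)

    γ : ℕ → ℕ → ℕ → ℤ
    γ i j d = gammaTerm i j d f
    m m′ : ℕ → ℕ → ℕ
    m  = xyDegree n
    m′ = xyDegree (suc n)

    l₁ l₂ l₃ l₄ r₁ r₂ r₃ r₄ : ℕ → ℕ → ℤ
    l₁ i j = gaux k (+ i - + 1) (+ j) * γ i j (m′ i j)
    l₂ i j = + 4 * (+ 1 + + i) * gaux k (+ i + + 1) (+ j - + 1) * γ i j (m′ i j)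
    l₃ i j = + 2 * + j * gaux k (+ i) (+ j) * γ i j (m′ i j)
    l₄ i j = + 4 * (+ n + + 2 - + i - + 2 * + j) * gaux k (+ i) (+ j - + 1) * γ i j (m′ i j)
    r₁ i j = gaux k (+ i) (+ j) * γ (suc i) j (m i j)
    r₂ i j = gaux k (+ i) (+ j) * ((+ 4 * + i) * γ (i ∸ 1) (suc j) (m i j))
    r₃ i j = gaux k (+ i) (+ j) * ((+ 2 * + j) * γ i j (suc (m i j)))
    r₄ i j = gaux k (+ i) (+ j) * ((+ 4 * + m i j) * γ i (suc j) (m i j ∸ 1))

    vanishˡ : ∀ {a : ℤ} b → a ≡ + 0 → a * b ≡ + 0
    vanishˡ b refl = ℤP.*-zeroˡ b

    outside-top : ∀ i j → n ℕ.≤ j → suc k ℕ.< i ℕ.+ 2 ℕ.* suc j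
    outside-top i j n≤j = ℕP.≤-trans (s≤s n≤j) (ℕP.≤-trans (ℕP.m≤m+n (suc j) _) (ℕP.m≤n+m _ i))

  expand-g : ∀ i j → gaux (suc k) (+ i) (+ j) * γ i j (m′ i j) ≡ l₁ i j + l₂ i j + l₃ i j + l₄ i j
  expand-g i j = distribʳ (gaux k (+ i - + 1) (+ j)) (+ 4 * (+ 1 + + i) * gaux k (+ i + + 1) (+ j - + 1))
                          (+ 2 * + j * gaux k (+ i) (+ j)) (+ 4 * (+ n + + 2 - + i - + 2 * + j) * gaux k (+ i) (+ j - + 1))
                          (γ i j (m′ i j))
    where
    distribʳ : ∀ a b c d x → (a + b + c + d) * x ≡ a * x + b * x + c * x + d * x
    distribʳ = solve-∀

  expand-T : ∀ i j → gaux k (+ i) (+ j) * gammaTerm i j (m i j) (Tᵀ f) ≡ r₁ i j + r₂ i j + r₃ i j + r₄ i j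
  expand-T i j = trans (cong (gaux k (+ i) (+ j) *_) (gammaTerm-Tᵀ (m i j) i j f))
                       (distribˡ (gaux k (+ i) (+ j)) (γ (suc i) j (m i j)) ((+ 4 * + i) * γ (i ∸ 1) (suc j) (m i j))
                                 ((+ 2 * + j) * γ i j (suc (m i j))) ((+ 4 * + m i j) * γ i (suc j) (m i j ∸ 1)))
    where
    distribˡ : ∀ g a b c d → g * (a + b + c + d) ≡ g * a + g * b + g * c + g * d
    distribˡ = solve-∀

  term₁-shift : ∑∑ R l₁ ≡ ∑∑ R r₁
  term₁-shift = ∑-upTo-shift (suc n) (λ i → ∑ (upTo R) (l₁ i)) (λ i → ∑ (upTo R) (r₁ i))
    (∑-zero (upTo R) (λ j → vanishˡ (γ 0 j (m′ 0 j)) (gaux-outside k -[1+ 0 ] (+ j) tt)))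
    (∑-zero (upTo R) (λ j → vanishˡ (γ (suc (suc n)) j (m (suc n) j))
                                    (gaux-outsideℕ k (suc n) j (ℕP.≤-trans (ℕP.n<1+n n) (ℕP.m≤m+n (suc n) _)))))
    (λ i → refl)

  term₂-same : ∀ i j → r₂ (suc i) j ≡ l₂ i (suc j)
  term₂-same i j = begin
    gaux k (+ suc i) (+ j) * ((+ 4 * + suc i) * γ i (suc j) (m (suc i) j))
      ≡⟨ cong₂ (λ a d → gaux k (+ a) (+ j) * ((+ 4 * + suc i) * γ i (suc j) d))
               (ℕP.+-comm 1 i) (sym (xyDegree-sucʲ n i j)) ⟩
    gaux k (+ i + + 1) (+ j) * ((+ 4 * + suc i) * γ i (suc j) (m′ i (suc j)))
      ≡⟨ reassoc (gaux k (+ i + + 1) (+ j)) (+ 4 * + suc i) (γ i (suc j) (m′ i (suc j))) ⟩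
    l₂ i (suc j) ∎
    where
    reassoc : ∀ a b c → a * (b * c) ≡ b * a * c
    reassoc = solve-∀

  term₂-shift : ∑∑ R l₂ ≡ ∑∑ R r₂
  term₂-shift = begin
    ∑∑ R l₂
      ≡⟨ ∑-cong (upTo R) (λ i → ∑-upTo-shift (suc n) (l₂ i) (λ j → l₂ i (suc j))
           (vanishˡ (γ i 0 (m′ i 0)) (*-zeroʳ-≡ (+ 4 * (+ 1 + + i)) (gaux-outside k (+ i + + 1) -[1+ 0 ] tt)))
           (vanishˡ (γ i R (m′ i R)) (*-zeroʳ-≡ (+ 4 * (+ 1 + + i))
              (gaux-outside k (+ i + + 1) (+ suc n) (outside-top (i ℕ.+ 1) n ℕP.≤-refl))))
           (λ j → refl)) ⟩
    ∑ (upTo R) (λ i → ∑ (upTo R) (λ j → l₂ i (suc j)))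
      ≡⟨ ∑-upTo-shift (suc n) (λ i → ∑ (upTo R) (r₂ i)) (λ i → ∑ (upTo R) (λ j → l₂ i (suc j)))
           (∑-zero (upTo R) (λ j → *-zeroʳ-≡ (gaux k (+ 0) (+ j)) (ℤP.*-zeroˡ (γ 0 (suc j) (m 0 j)))))
           (∑-zero (upTo R) (λ j → vanishˡ (γ (suc n) (suc j) (m′ (suc n) (suc j)))
              (*-zeroʳ-≡ (+ 4 * (+ 1 + + suc n)) (gaux-outsideℕ k (suc n ℕ.+ 1) j
                 (ℕP.≤-trans (ℕP.m≤m+n (suc n) 1) (ℕP.m≤m+n (suc n ℕ.+ 1) (2 ℕ.* j)))))))
           (λ i → ∑-cong (upTo R) (term₂-same i)) ⟨
    ∑∑ R r₂ ∎

  term₃-same : ∀ i j → l₃ i j ≡ r₃ i j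
  term₃-same i j with i ℕ.+ 2 ℕ.* j ℕ.≤? n
  ... | yes i+2j≤n =
    trans (cong (λ d → + 2 * + j * gaux k (+ i) (+ j) * γ i j d) (xyDegree-suc n i j i+2j≤n))
          (reassoc (+ 2 * + j) (gaux k (+ i) (+ j)) (γ i j (suc (m i j))))
    where
    reassoc : ∀ a b c → a * b * c ≡ b * (a * c)
    reassoc = solve-∀
  ... | no i+2j≰n =
    trans (vanishˡ (γ i j (m′ i j)) (*-zeroʳ-≡ (+ 2 * + j) g≡0)) (sym (vanishˡ ((+ 2 * + j) * γ i j (suc (m i j))) g≡0))
    where
    g≡0 : gaux k (+ i) (+ j) ≡ + 0
    g≡0 = gaux-outsideℕ k i j (ℕP.≰⇒> i+2j≰n)

  term₄-same : ∀ i j → l₄ i (suc j) ≡ r₄ i j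
  term₄-same i j with i ℕ.+ 2 ℕ.* j ℕ.≤? n
  ... | yes i+2j≤n = begin
    + 4 * (+ n + + 2 - + i - + 2 * + suc j) * gaux k (+ i) (+ j) * γ i (suc j) (m′ i (suc j))
      ≡⟨ cong₂ (λ c d → + 4 * c * gaux k (+ i) (+ j) * γ i (suc j) d)
               (coefficient≡xyDegree k i j i+2j≤n) (xyDegree-sucʲ′ n i j) ⟩
    + 4 * + m i j * gaux k (+ i) (+ j) * γ i (suc j) (m i j ∸ 1)
      ≡⟨ reassoc (+ 4 * + m i j) (gaux k (+ i) (+ j)) (γ i (suc j) (m i j ∸ 1)) ⟩
    r₄ i j ∎
    where
    reassoc : ∀ a b c → a * b * c ≡ b * (a * c)
    reassoc = solve-∀
  ... | no i+2j≰n =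
    trans (vanishˡ (γ i (suc j) (m′ i (suc j))) (*-zeroʳ-≡ (+ 4 * (+ n + + 2 - + i - + 2 * + suc j)) g≡0))
          (sym (vanishˡ ((+ 4 * + m i j) * γ i (suc j) (m i j ∸ 1)) g≡0))
    where
    g≡0 : gaux k (+ i) (+ j) ≡ + 0
    g≡0 = gaux-outsideℕ k i j (ℕP.≰⇒> i+2j≰n)

  term₄-shift : ∑∑ R l₄ ≡ ∑∑ R r₄
  term₄-shift = ∑-cong (upTo R) (λ i → ∑-upTo-shift (suc n) (l₄ i) (r₄ i)
    (vanishˡ (γ i 0 (m′ i 0)) (*-zeroʳ-≡ (+ 4 * (+ n + + 2 - + i - + 2 * + 0)) (gaux-outside k (+ i) -[1+ 0 ] tt)))
    (vanishˡ ((+ 4 * + m i (suc n)) * γ i (suc (suc n)) (m i (suc n) ∸ 1))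
             (gaux-outsideℕ k i (suc n) (outside-top i n ℕP.≤-refl)))
    (term₄-same i))

  -- Each of the four terms of the recurrence for g matches one term of T after a shift of (i , j).
  gammaSum-Tᵀ : gammaSum (2 ℕ.+ k) (3 ℕ.+ k) f ≡ gammaSum (suc k) (3 ℕ.+ k) (Tᵀ f)
  gammaSum-Tᵀ = begin
    gammaSum (suc n) R f                             ≡⟨ ∑∑-cong R expand-g ⟩
    ∑∑ R (λ i j → l₁ i j + l₂ i j + l₃ i j + l₄ i j) ≡⟨ ∑∑-+₄ R l₁ l₂ l₃ l₄ ⟩
    ∑∑ R l₁ + ∑∑ R l₂ + ∑∑ R l₃ + ∑∑ R l₄
      ≡⟨ cong₂ _+_ (cong₂ _+_ (cong₂ _+_ term₁-shift term₂-shift) (∑∑-cong R term₃-same)) term₄-shift ⟩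
    ∑∑ R r₁ + ∑∑ R r₂ + ∑∑ R r₃ + ∑∑ R r₄             ≡⟨ ∑∑-+₄ R r₁ r₂ r₃ r₄ ⟨
    ∑∑ R (λ i j → r₁ i j + r₂ i j + r₃ i j + r₄ i j) ≡⟨ ∑∑-cong R expand-T ⟨
    gammaSum n R (Tᵀ f)                              ∎

/2<⇒<2* : ∀ m j → m / 2 ℕ.< j → m ℕ.< 2 ℕ.* j
/2<⇒<2* m j m/2<j = ℕP.≰⇒> (λ 2j≤m → ℕP.<⇒≱ m/2<j
  (subst (ℕ._≤ m / 2) (m*n/n≡m j 2) (/-monoˡ-≤ 2 (subst (ℕ._≤ m) (ℕP.*-comm 2 j) 2j≤m))))

^-distribʳ-* : ∀ (x y : ℤ) j → (x * y) ℤ.^ j ≡ (x ℤ.^ j) * (y ℤ.^ j)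
^-distribʳ-* x y zero    = refl
^-distribʳ-* x y (suc j) = trans (cong ((x * y) *_) (^-distribʳ-* x y j)) (interchange x y (x ℤ.^ j) (y ℤ.^ j))
  where
  interchange : ∀ x y a b → (x * y) * (a * b) ≡ (x * a) * (y * b)
  interchange = solve-∀

gammaExpansion≡gammaSum : ∀ k x y z →
  gammaExpansion (suc k) x y z ≡ gammaSum (suc k) (suc (suc k)) (evalAt x y z)
gammaExpansion≡gammaSum k x y z = ∑-cong (upTo (suc n)) λ i → begin
  (z ℤ.^ i) * ∑ (upTo (suc ((n ∸ i) / 2))) (h i)
    ≡⟨ cong ((z ℤ.^ i) *_) (∑-upTo-truncate (h i) (s≤s (ℕP.≤-trans (m/n≤m (n ∸ i) 2) (ℕP.m∸n≤m n i)))
                                             (λ j → h≡0 i j ∘ outside i j)) ⟨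
  (z ℤ.^ i) * ∑ (upTo (suc n)) (h i)
    ≡⟨ ∑-*ˡ (upTo (suc n)) (z ℤ.^ i) (h i) ⟨
  ∑ (upTo (suc n)) (λ j → (z ℤ.^ i) * h i j)
    ≡⟨ ∑-cong (upTo (suc n)) (term i) ⟩
  ∑ (upTo (suc n)) (λ j → g n (+ i) (+ j) * gammaTerm i j (xyDegree n i j) (evalAt x y z)) ∎
  where
  open ≡-Reasoning
  n : ℕ
  n = suc k
  h : ℕ → ℕ → ℤ
  h i j = g n (+ i) (+ j) * ((x * y) ℤ.^ j) * ((x + y) ℤ.^ xyDegree n i j)
  outside : ∀ i j → suc ((n ∸ i) / 2) ℕ.≤ j → n ℕ.< i ℕ.+ 2 ℕ.* j
  outside i j le = ℕP.≤-<-trans (ℕP.m≤n+m∸n n i) (ℕP.+-monoʳ-< i (/2<⇒<2* (n ∸ i) j le))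
  h≡0 : ∀ i j → n ℕ.< i ℕ.+ 2 ℕ.* j → h i j ≡ + 0
  h≡0 i j out rewrite gaux-outsideℕ k i j out =
    trans (cong (_* ((x + y) ℤ.^ xyDegree n i j)) (ℤP.*-zeroˡ ((x * y) ℤ.^ j))) (ℤP.*-zeroˡ ((x + y) ℤ.^ xyDegree n i j))
  term : ∀ i j → (z ℤ.^ i) * h i j ≡ g n (+ i) (+ j) * gammaTerm i j (xyDegree n i j) (evalAt x y z)
  term i j = begin
    (z ℤ.^ i) * (g n (+ i) (+ j) * ((x * y) ℤ.^ j) * ((x + y) ℤ.^ xyDegree n i j))
      ≡⟨ cong (λ t → (z ℤ.^ i) * (g n (+ i) (+ j) * t * ((x + y) ℤ.^ xyDegree n i j))) (^-distribʳ-* x y j) ⟩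
    (z ℤ.^ i) * (g n (+ i) (+ j) * ((x ℤ.^ j) * (y ℤ.^ j)) * ((x + y) ℤ.^ xyDegree n i j))
      ≡⟨ reorder (z ℤ.^ i) (g n (+ i) (+ j)) (x ℤ.^ j) (y ℤ.^ j) ((x + y) ℤ.^ xyDegree n i j) ⟩
    g n (+ i) (+ j) * (((x + y) ℤ.^ xyDegree n i j) * evalAt x y z (j , j , i))
      ≡⟨ cong (g n (+ i) (+ j) *_) (gammaTerm-evalAt (xyDegree n i j) i j x y z) ⟨
    g n (+ i) (+ j) * gammaTerm i j (xyDegree n i j) (evalAt x y z) ∎
    where
    reorder : ∀ Z G a b U → Z * (G * (a * b) * U) ≡ G * (U * (a * b * Z))
    reorder = solve-∀

-- Positions are 0-based: at π i is the value π(i + 1).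
at : ∀ {m} → Vec ℤ m → ℕ → ℤ
at v i = ev v (suc i)

∣at∣ : ∀ {m} → Vec ℤ m → ℕ → ℕ
∣at∣ v i = ∣ at v i ∣

update : ∀ {m} → Vec ℤ m → ℕ → ℤ → Vec ℤ m
update []      k       b = []
update (a ∷ v) zero    b = b ∷ v
update (a ∷ v) (suc k) b = a ∷ update v k b

ev-∷ʳ : ∀ {m} (v : Vec ℤ m) a j → j ℕ.≤ m → ev (v ∷ʳ a) j ≡ ev v j
ev-∷ʳ []      a zero          _         = refl
ev-∷ʳ (b ∷ v) a zero          _         = refl
ev-∷ʳ (b ∷ v) a (suc zero)    _         = refl
ev-∷ʳ (b ∷ v) a (suc (suc j)) (s≤s j≤m) = ev-∷ʳ v a (suc j) j≤m

at-∷ʳ : ∀ {m} (v : Vec ℤ m) a i → i ℕ.< m → at (v ∷ʳ a) i ≡ at v i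
at-∷ʳ v a i = ev-∷ʳ v a (suc i)

at-∷ʳ-last : ∀ {m} (v : Vec ℤ m) a → at (v ∷ʳ a) m ≡ a
at-∷ʳ-last []      a = refl
at-∷ʳ-last (b ∷ v) a = at-∷ʳ-last v a

at-update : ∀ {m} (v : Vec ℤ m) k b → k ℕ.< m → at (update v k b) k ≡ b
at-update (a ∷ v) zero    b _         = refl
at-update (a ∷ v) (suc k) b (s≤s k<m) = at-update v k b k<m

at-update-other : ∀ {m} (v : Vec ℤ m) k b i → i ≢ k → at (update v k b) i ≡ at v i
at-update-other []      k       b i       i≢k = refl
at-update-other (a ∷ v) zero    b zero    i≢k = ⊥-elim (i≢k refl)
at-update-other (a ∷ v) zero    b (suc i) i≢k = refl
at-update-other (a ∷ v) (suc k) b zero    i≢k = refl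
at-update-other (a ∷ v) (suc k) b (suc i) i≢k = at-update-other v k b i (i≢k ∘ cong suc)

update-update : ∀ {m} (v : Vec ℤ m) k b c → update (update v k c) k b ≡ update v k b
update-update []      k       b c = refl
update-update (a ∷ v) zero    b c = refl
update-update (a ∷ v) (suc k) b c = cong (a ∷_) (update-update v k b c)

update-at : ∀ {m} (v : Vec ℤ m) k → k ℕ.< m → update v k (at v k) ≡ v
update-at (a ∷ v) zero    _         = refl
update-at (a ∷ v) (suc k) (s≤s k<m) = cong (a ∷_) (update-at v k k<m)

m<1+n∧m≢n⇒m<n : ∀ {m n} → m ℕ.< suc n → m ≢ n → m ℕ.< n
m<1+n∧m≢n⇒m<n m<1+n m≢n = ℕP.≤∧≢⇒< (ℕP.m<1+n⇒m≤n m<1+n) m≢n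

indicator : Bool → ℕ
indicator b = if b then 1 else 0

countBelow : ℕ → (ℕ → Bool) → ℕ
countBelow zero    q = 0
countBelow (suc m) q = countBelow m q ℕ.+ indicator (q m)

count-++ : ∀ {A : Set} (p : A → Bool) xs ys → count p (xs ++ ys) ≡ count p xs ℕ.+ count p ys
count-++ p xs ys = trans (cong length (ListP.filter-++ _ xs ys)) (ListP.length-++ (filter _ xs))

count-singleton : ∀ {A : Set} (p : A → Bool) a → count p (a ∷ []) ≡ indicator (p a)
count-singleton p a with p a
... | true  = refl
... | false = refl

count-map-upTo : ∀ {A : Set} (p : A → Bool) (h : ℕ → A) m → count p (map h (upTo m)) ≡ countBelow m (p ∘ h)
count-map-upTo p h zero    = refl
count-map-upTo p h (suc m) = begin
  count p (map h (upTo (suc m)))                   ≡⟨ cong (count p ∘ map h) (ListP.upTo-∷ʳ m) ⟨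
  count p (map h (upTo m List.∷ʳ m))               ≡⟨ cong (count p) (ListP.map-++ h (upTo m) (m ∷ [])) ⟩
  count p (map h (upTo m) ++ h m ∷ [])             ≡⟨ count-++ p (map h (upTo m)) (h m ∷ []) ⟩
  count p (map h (upTo m)) ℕ.+ count p (h m ∷ [])  ≡⟨ cong₂ ℕ._+_ (count-map-upTo p h m) (count-singleton p (h m)) ⟩
  countBelow (suc m) (p ∘ h)                       ∎
  where open ≡-Reasoning

countBelow-cong : ∀ m {q q′ : ℕ → Bool} → (∀ i → i ℕ.< m → q i ≡ q′ i) → countBelow m q ≡ countBelow m q′
countBelow-cong zero    eq = refl
countBelow-cong (suc m) eq =
  cong₂ (λ c b → c ℕ.+ indicator b) (countBelow-cong m (λ i i<m → eq i (ℕP.m<n⇒m<1+n i<m))) (eq m (ℕP.n<1+n m))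

countBelow-update : ∀ m k (q q′ : ℕ → Bool) → k ℕ.< m → (∀ i → i ℕ.< m → i ≢ k → q i ≡ q′ i) →
                    countBelow m q′ ℕ.+ indicator (q k) ≡ countBelow m q ℕ.+ indicator (q′ k)
countBelow-update (suc m) k q q′ k<1+m eq with k ℕ.≟ m
... | yes refl = begin
  countBelow k q′ ℕ.+ indicator (q′ k) ℕ.+ indicator (q k)
    ≡⟨ cong (λ c → c ℕ.+ indicator (q′ k) ℕ.+ indicator (q k))
            (countBelow-cong k (λ i i<k → sym (eq i (ℕP.m<n⇒m<1+n i<k) (ℕP.<⇒≢ i<k)))) ⟩
  countBelow k q ℕ.+ indicator (q′ k) ℕ.+ indicator (q k)
    ≡⟨ xy∙z≈xz∙y (countBelow k q) (indicator (q′ k)) (indicator (q k)) ⟩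
  countBelow k q ℕ.+ indicator (q k) ℕ.+ indicator (q′ k) ∎
  where open ≡-Reasoning
... | no k≢m = begin
  countBelow m q′ ℕ.+ indicator (q′ m) ℕ.+ indicator (q k)
    ≡⟨ xy∙z≈xz∙y (countBelow m q′) (indicator (q′ m)) (indicator (q k)) ⟩
  countBelow m q′ ℕ.+ indicator (q k) ℕ.+ indicator (q′ m)
    ≡⟨ cong₂ ℕ._+_ (countBelow-update m k q q′ k<m (λ i i<m → eq i (ℕP.m<n⇒m<1+n i<m)))
                   (cong indicator (sym (eq m (ℕP.n<1+n m) (k≢m ∘ sym)))) ⟩
  countBelow m q ℕ.+ indicator (q′ k) ℕ.+ indicator (q m)
    ≡⟨ xy∙z≈xz∙y (countBelow m q) (indicator (q′ k)) (indicator (q m)) ⟩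
  countBelow m q ℕ.+ indicator (q m) ℕ.+ indicator (q′ k) ∎
  where
  open ≡-Reasoning
  k<m : k ℕ.< m
  k<m = m<1+n∧m≢n⇒m<n k<1+m k≢m

∑-indicator : ∀ m (q : ℕ → Bool) c → ∑ (upTo m) (λ k → if q k then c else + 0) ≡ + countBelow m q * c
∑-indicator zero    q c = sym (ℤP.*-zeroˡ c)
∑-indicator (suc m) q c = begin
  ∑ (upTo (suc m)) (λ k → if q k then c else + 0)
    ≡⟨ ∑-upTo-suc m _ ⟩
  ∑ (upTo m) (λ k → if q k then c else + 0) + (if q m then c else + 0)
    ≡⟨ cong₂ _+_ (∑-indicator m q c) (if≡indicator* (q m)) ⟩
  + countBelow m q * c + + indicator (q m) * c
    ≡⟨ ℤP.*-distribʳ-+ c (+ countBelow m q) (+ indicator (q m)) ⟨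
  + countBelow (suc m) q * c ∎
  where
  open ≡-Reasoning
  if≡indicator* : ∀ b → (if b then c else + 0) ≡ + indicator b * c
  if≡indicator* true  = sym (ℤP.*-identityˡ c)
  if≡indicator* false = sym (ℤP.*-zeroˡ c)

⌊⌋≡true : ∀ {P : Set} (d : Dec P) → P → ⌊ d ⌋ ≡ true
⌊⌋≡true (yes _) _ = refl
⌊⌋≡true (no ¬p) p = ⊥-elim (¬p p)

⌊⌋≡false : ∀ {P : Set} (d : Dec P) → ¬ P → ⌊ d ⌋ ≡ false
⌊⌋≡false (yes p) ¬p = ⊥-elim (¬p p)
⌊⌋≡false (no _)  _  = refl

⌊⌋≡true⁻ : ∀ {P : Set} (d : Dec P) → ⌊ d ⌋ ≡ true → P
⌊⌋≡true⁻ (yes p) _ = p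

not⌊⌋≡true⁻ : ∀ {P : Set} (d : Dec P) → not ⌊ d ⌋ ≡ true → ¬ P
not⌊⌋≡true⁻ (no ¬p) _ = ¬p

not⌊⌋≡true : ∀ {P : Set} (d : Dec P) → ¬ P → not ⌊ d ⌋ ≡ true
not⌊⌋≡true d ¬p = cong not (⌊⌋≡false d ¬p)

∧≡true⁻ : ∀ {a b : Bool} → a ∧ b ≡ true → (a ≡ true) × (b ≡ true)
∧≡true⁻ {true} {true} refl = refl , refl

∧≡true : ∀ {a b : Bool} → a ≡ true → b ≡ true → a ∧ b ≡ true
∧≡true refl refl = refl

Bool-≡ : ∀ {a b : Bool} → (a ≡ true → b ≡ true) → (b ≡ true → a ≡ true) → a ≡ b
Bool-≡ {true}  {true}  _ _ = refl
Bool-≡ {true}  {false} f _ = sym (f refl)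
Bool-≡ {false} {true}  _ g = g refl
Bool-≡ {false} {false} _ _ = refl

allB≡true⁻ : ∀ {A : Set} (p : A → Bool) xs → allB p xs ≡ true → All (λ x → p x ≡ true) xs
allB≡true⁻ p []       _  = []
allB≡true⁻ p (x ∷ xs) eq = let px , pxs = ∧≡true⁻ eq in px ∷ allB≡true⁻ p xs pxs

allB≡true : ∀ {A : Set} (p : A → Bool) xs → All (λ x → p x ≡ true) xs → allB p xs ≡ true
allB≡true p []       []         = refl
allB≡true p (x ∷ xs) (px ∷ pxs) = ∧≡true px (allB≡true p xs pxs)

distinct⇒unique : ∀ xs → distinct xs ≡ true → Unique xs
distinct⇒unique []       _  = []
distinct⇒unique (x ∷ xs) eq =
  let x∉xs , u = ∧≡true⁻ eq in
  All.map (λ {y} → not⌊⌋≡true⁻ (x ℕ.≟ y)) (allB≡true⁻ _ xs x∉xs) ∷ distinct⇒unique xs u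

unique⇒distinct : ∀ xs → Unique xs → distinct xs ≡ true
unique⇒distinct []       []         = refl
unique⇒distinct (x ∷ xs) (x∉xs ∷ u) =
  ∧≡true (allB≡true _ xs (All.map (λ {y} → not⌊⌋≡true (x ℕ.≟ y)) x∉xs)) (unique⇒distinct xs u)

InRange : ℕ → ℕ → Set
InRange n x = 1 ℕ.≤ x × x ℕ.≤ n

private
  all-remove : ∀ {P : ℕ → Set} (ys : List ℕ) {c zs} → All P (ys ++ c ∷ zs) → All P (ys ++ zs) × P c
  all-remove ys pys+c+zs with pys , pc ∷ pzs ← AllP.++⁻ ys pys+c+zs = AllP.++⁺ pys pzs , pc

  unique-remove : ∀ (ys : List ℕ) {c zs} → Unique (ys ++ c ∷ zs) → Unique (ys ++ zs) × All (c ≢_) (ys ++ zs)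
  unique-remove []       (c∉zs ∷ u) = u , c∉zs
  unique-remove (y ∷ ys) (y∉ ∷ u)
    with u′ , c∉ ← unique-remove ys u | y∉′ , y≢c ← all-remove ys y∉ = (y∉′ ∷ u′) , ((y≢c ∘ sym) ∷ c∉)

  count-remove : ∀ (q : ℕ → Bool) (ys : List ℕ) {c zs} →
                 count q (ys ++ c ∷ zs) ≡ indicator (q c) ℕ.+ count q (ys ++ zs)
  count-remove q ys {c} {zs} = begin
    count q (ys ++ c ∷ zs)                                   ≡⟨ count-++ q ys (c ∷ zs) ⟩
    count q ys ℕ.+ count q (c ∷ zs)                          ≡⟨ cong (count q ys ℕ.+_) (count-++ q (c ∷ []) zs) ⟩
    count q ys ℕ.+ (count q (c ∷ []) ℕ.+ count q zs)         ≡⟨ cong (λ t → count q ys ℕ.+ (t ℕ.+ count q zs)) (count-singleton q c) ⟩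
    count q ys ℕ.+ (indicator (q c) ℕ.+ count q zs)          ≡⟨ x∙yz≈y∙xz (count q ys) (indicator (q c)) (count q zs) ⟩
    indicator (q c) ℕ.+ (count q ys ℕ.+ count q zs)          ≡⟨ cong (indicator (q c) ℕ.+_) (count-++ q ys zs) ⟨
    indicator (q c) ℕ.+ count q (ys ++ zs)                   ∎
    where open ≡-Reasoning

  inRange-pred : ∀ {n x} → InRange (suc n) x → suc n ≢ x → InRange n x
  inRange-pred (1≤x , x≤1+n) n+1≢x = 1≤x , ℕP.≤-pred (ℕP.≤∧≢⇒< x≤1+n (n+1≢x ∘ sym))

-- The second component, that every predicate is counted on xs as on 1, …, n, says that
-- xs is then a rearrangement of 1, …, n.
pigeonhole : ∀ n xs → Unique xs → All (InRange n) xs →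
             length xs ℕ.≤ n × (length xs ≡ n → ∀ q → count q xs ≡ countBelow n (q ∘ suc))
pigeonhole zero    []       _ _                  = z≤n , λ _ _ → refl
pigeonhole zero    (x ∷ xs) _ ((1≤x , x≤0) ∷ _) with () ← ℕP.≤-trans 1≤x x≤0
pigeonhole (suc n) xs u r with suc n ∈? xs
... | yes n+1∈xs
  with ys , zs , refl ← ∈-∃++ n+1∈xs
  with u′ , n+1∉ys++zs ← unique-remove ys u
  with r′ , _ ← all-remove ys r
  with length≤ , counts ← pigeonhole n (ys ++ zs) u′ (All.zipWith (uncurry inRange-pred) (r′ , n+1∉ys++zs)) =
  subst (ℕ._≤ suc n) (sym (ListP.length-++-sucʳ ys (suc n) zs)) (s≤s length≤) ,
  λ length≡ q → begin
    count q (ys ++ suc n ∷ zs)                       ≡⟨ count-remove q ys ⟩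
    indicator (q (suc n)) ℕ.+ count q (ys ++ zs)
      ≡⟨ cong (indicator (q (suc n)) ℕ.+_)
              (counts (ℕP.suc-injective (trans (sym (ListP.length-++-sucʳ ys (suc n) zs)) length≡)) q) ⟩
    indicator (q (suc n)) ℕ.+ countBelow n (q ∘ suc) ≡⟨ ℕP.+-comm (indicator (q (suc n))) _ ⟩
    countBelow (suc n) (q ∘ suc)                     ∎
  where open ≡-Reasoning
... | no n+1∉xs
  with length≤ , _ ← pigeonhole n xs u (All.zipWith (uncurry inRange-pred) (r , AllP.¬Any⇒All¬ xs n+1∉xs)) =
  ℕP.m≤n⇒m≤1+n length≤ , λ length≡ → ⊥-elim (ℕP.<-irrefl length≡ (s≤s length≤))

All-map-upTo⁻ : ∀ {A : Set} {P : A → Set} (h : ℕ → A) m → All P (map h (upTo m)) → ∀ i → i ℕ.< m → P (h i)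
All-map-upTo⁻ h m ps i i<m = AllP.applyUpTo⁻ id m (AllP.map⁻ ps) i<m

All-map-upTo⁺ : ∀ {A : Set} {P : A → Set} (h : ℕ → A) m → (∀ i → i ℕ.< m → P (h i)) → All P (map h (upTo m))
All-map-upTo⁺ h m ps = AllP.map⁺ (AllP.applyUpTo⁺₁ id m (λ {i} i<m → ps i i<m))

count-applyUpTo : ∀ (q : ℕ → Bool) h m → count q (applyUpTo h m) ≡ countBelow m (q ∘ h)
count-applyUpTo q h m = trans (cong (count q) (sym (ListP.map-upTo h m))) (count-map-upTo q h m)

InjectiveBelow : ℕ → (ℕ → ℕ) → Set
InjectiveBelow m h = ∀ i j → i ℕ.< m → j ℕ.< m → h i ≡ h j → i ≡ j

unique⇒injectiveBelow : ∀ m h → Unique (applyUpTo h m) → InjectiveBelow m h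
unique⇒injectiveBelow (suc m) h (h0∉ ∷ u) zero    zero    _         _         _  = refl
unique⇒injectiveBelow (suc m) h (h0∉ ∷ u) zero    (suc j) _         (s≤s j<m) eq =
  ⊥-elim (AllP.applyUpTo⁻ (h ∘ suc) m h0∉ j<m eq)
unique⇒injectiveBelow (suc m) h (h0∉ ∷ u) (suc i) zero    (s≤s i<m) _         eq =
  ⊥-elim (AllP.applyUpTo⁻ (h ∘ suc) m h0∉ i<m (sym eq))
unique⇒injectiveBelow (suc m) h (h0∉ ∷ u) (suc i) (suc j) (s≤s i<m) (s≤s j<m) eq =
  cong suc (unique⇒injectiveBelow m (h ∘ suc) u i j i<m j<m eq)

injectiveBelow⇒unique : ∀ m h → InjectiveBelow m h → Unique (applyUpTo h m)
injectiveBelow⇒unique m h inj =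
  UniqueP.applyUpTo⁺₁ h m (λ i<j j<m eq → ℕP.<⇒≢ i<j (inj _ _ (ℕP.<-trans i<j j<m) j<m eq))

AbsInjective : ∀ {m} → Vec ℤ m → Set
AbsInjective {m} v = InjectiveBelow m (∣at∣ v)

AbsBounded : ℕ → ∀ {m} → Vec ℤ m → Set
AbsBounded n {m} v = ∀ i → i ℕ.< m → InRange n (∣at∣ v i)

distinctAbs : ∀ {m} → Vec ℤ m → Bool
distinctAbs v = distinct (map ∣_∣ (toList v))

toList≡applyUpTo-at : ∀ {m} (v : Vec ℤ m) → toList v ≡ applyUpTo (at v) m
toList≡applyUpTo-at []      = refl
toList≡applyUpTo-at (a ∷ v) = cong (a ∷_) (toList≡applyUpTo-at v)

map-∣∣-toList : ∀ {m} (v : Vec ℤ m) → map ∣_∣ (toList v) ≡ applyUpTo (∣at∣ v) m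
map-∣∣-toList {m} v = trans (cong (map ∣_∣) (toList≡applyUpTo-at v)) (ListP.map-applyUpTo (at v) ∣_∣ m)

distinctAbs⇒absInjective : ∀ {m} (v : Vec ℤ m) → distinctAbs v ≡ true → AbsInjective v
distinctAbs⇒absInjective {m} v eq =
  unique⇒injectiveBelow m (∣at∣ v) (subst Unique (map-∣∣-toList v) (distinct⇒unique _ eq))

absInjective⇒distinctAbs : ∀ {m} (v : Vec ℤ m) → AbsInjective v → distinctAbs v ≡ true
absInjective⇒distinctAbs {m} v inj =
  unique⇒distinct _ (subst Unique (sym (map-∣∣-toList v)) (injectiveBelow⇒unique m (∣at∣ v) inj))

absInjective⇒length≤ : ∀ {m} n (v : Vec ℤ m) → AbsInjective v → AbsBounded n v → m ℕ.≤ n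
absInjective⇒length≤ {m} n v inj bounded =
  subst (ℕ._≤ n) (ListP.length-applyUpTo (∣at∣ v) m)
    (proj₁ (pigeonhole n (applyUpTo (∣at∣ v) m) (injectiveBelow⇒unique m (∣at∣ v) inj)
                         (AllP.applyUpTo⁺₁ (∣at∣ v) m (λ {i} → bounded i))))

-- i ↦ |π(i)| − 1 is a permutation of the positions of a signed permutation.
countBelow-reindex : ∀ {m} (v : Vec ℤ m) → AbsInjective v → AbsBounded m v →
                     ∀ q → countBelow m (q ∘ ∣at∣ v) ≡ countBelow m (q ∘ suc)
countBelow-reindex {m} v inj bounded q =
  trans (sym (count-applyUpTo q (∣at∣ v) m))
        (proj₂ (pigeonhole m (applyUpTo (∣at∣ v) m) (injectiveBelow⇒unique m (∣at∣ v) inj)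
                             (AllP.applyUpTo⁺₁ (∣at∣ v) m (λ {i} → bounded i)))
               (ListP.length-applyUpTo (∣at∣ v) m) q)

NoFixedPoint : ∀ {m} → Vec ℤ m → Set
NoFixedPoint {m} v = ∀ i → i ℕ.< m → at v i ≢ + suc i

fixedPointFree⇒noFixedPoint : ∀ {m} (v : Vec ℤ m) → fixedPointFree v ≡ true → NoFixedPoint v
fixedPointFree⇒noFixedPoint {m} v eq i i<m =
  not⌊⌋≡true⁻ (at v i ℤ.≟ + suc i) (All-map-upTo⁻ (λ k → suc k , at v k) m (allB≡true⁻ _ (graph v) eq) i i<m)

noFixedPoint⇒fixedPointFree : ∀ {m} (v : Vec ℤ m) → NoFixedPoint v → fixedPointFree v ≡ true
noFixedPoint⇒fixedPointFree {m} v nfp =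
  allB≡true _ (graph v) (All-map-upTo⁺ (λ k → suc k , at v k) m (λ i i<m → not⌊⌋≡true (at v i ℤ.≟ + suc i) (nfp i i<m)))

isDerangement : ∀ {m} → Vec ℤ m → Bool
isDerangement v = distinctAbs v ∧ fixedPointFree v

ifDerangement : ∀ {m} → Vec ℤ m → ℤ → ℤ
ifDerangement v r = if isDerangement v then r else + 0

withAbs : ∀ {m} → Vec ℤ m → ℕ → ℤ
withAbs []      j = + 0
withAbs (a ∷ v) j = if ⌊ ∣ a ∣ ℕ.≟ j ⌋ then a else withAbs v j

withAbs-at : ∀ {m} (v : Vec ℤ m) → AbsInjective v → ∀ i → i ℕ.< m → withAbs v (∣at∣ v i) ≡ at v i
withAbs-at (a ∷ v) inj zero    _         rewrite ⌊⌋≡true (∣ a ∣ ℕ.≟ ∣ a ∣) refl = refl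
withAbs-at (a ∷ v) inj (suc i) (s≤s i<m)
  rewrite ⌊⌋≡false (∣ a ∣ ℕ.≟ ∣at∣ v i) (λ eq → ℕP.0≢1+n (inj 0 (suc i) z<s (s≤s i<m) eq)) =
  withAbs-at v (λ i j i<m j<m eq → ℕP.suc-injective (inj (suc i) (suc j) (s≤s i<m) (s≤s j<m) eq)) i i<m

withAbs-absent : ∀ {m} (v : Vec ℤ m) j → (∀ i → i ℕ.< m → ∣at∣ v i ≢ j) → withAbs v j ≡ + 0
withAbs-absent []      j absent = refl
withAbs-absent (a ∷ v) j absent rewrite ⌊⌋≡false (∣ a ∣ ℕ.≟ j) (absent 0 z<s) =
  withAbs-absent v j (λ i i<m → absent (suc i) (s≤s i<m))

withAbs-abs : ∀ {m} (v : Vec ℤ m) j → ∣ withAbs v j ∣ ≡ j ⊎ withAbs v j ≡ + 0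
withAbs-abs []      j = inj₂ refl
withAbs-abs (a ∷ v) j with ∣ a ∣ ℕ.≟ j
... | yes ∣a∣≡j = inj₁ ∣a∣≡j
... | no  _     = withAbs-abs v j

-- Reindexed by j = |π(i)| − 1, wexc, aexc and single count the positions labelled x, y and z.
labelX labelY labelZ : ∀ {m} → Vec ℤ m → ℕ → Bool
labelX v j = ⌊ withAbs v (suc j) ℤ.<? at v j ⌋
labelY v j = ⌊ at v j ℤ.<? withAbs v (suc j) ⌋
labelZ v j = ⌊ at v j ℤ.≟ - (+ suc j) ⌋

countX countY countZ : ∀ {m} → Vec ℤ m → ℕ
countX {m} v = countBelow m (labelX v)
countY {m} v = countBelow m (labelY v)
countZ {m} v = countBelow m (labelZ v)

stats : ∀ {m} → Vec ℤ m → Monomial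
stats v = wexc v , aexc v , single v

single≡countZ : ∀ {m} (v : Vec ℤ m) → single v ≡ countZ v
single≡countZ {m} v = count-map-upTo _ (λ k → suc k , at v k) m

wexc≡countBelow : ∀ {m} (v : Vec ℤ m) → wexc v ≡ countBelow m (λ i → ⌊ at v i ℤ.<? ev v (∣at∣ v i) ⌋)
wexc≡countBelow {m} v = count-map-upTo _ (λ k → suc k , at v k) m

aexc≡countBelow : ∀ {m} (v : Vec ℤ m) → aexc v ≡ countBelow m (λ i → ⌊ ev v (∣at∣ v i) ℤ.<? at v i ⌋)
aexc≡countBelow {m} v = count-map-upTo _ (λ k → suc k , at v k) m

wexc≡countX : ∀ {m} (v : Vec ℤ m) → AbsInjective v → AbsBounded m v → wexc v ≡ countX v
wexc≡countX {m} v inj bounded = begin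
  wexc v
    ≡⟨ wexc≡countBelow v ⟩
  countBelow m (λ i → ⌊ at v i ℤ.<? ev v (∣at∣ v i) ⌋)
    ≡⟨ countBelow-cong m (λ i i<m → cong (λ t → ⌊ t ℤ.<? ev v (∣at∣ v i) ⌋) (sym (withAbs-at v inj i i<m))) ⟩
  countBelow m (λ i → ⌊ withAbs v (∣at∣ v i) ℤ.<? ev v (∣at∣ v i) ⌋)
    ≡⟨ countBelow-reindex v inj bounded (λ j → ⌊ withAbs v j ℤ.<? ev v j ⌋) ⟩
  countX v ∎
  where open ≡-Reasoning

aexc≡countY : ∀ {m} (v : Vec ℤ m) → AbsInjective v → AbsBounded m v → aexc v ≡ countY v
aexc≡countY {m} v inj bounded = begin
  aexc v
    ≡⟨ aexc≡countBelow v ⟩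
  countBelow m (λ i → ⌊ ev v (∣at∣ v i) ℤ.<? at v i ⌋)
    ≡⟨ countBelow-cong m (λ i i<m → cong (λ t → ⌊ ev v (∣at∣ v i) ℤ.<? t ⌋) (sym (withAbs-at v inj i i<m))) ⟩
  countBelow m (λ i → ⌊ ev v (∣at∣ v i) ℤ.<? withAbs v (∣at∣ v i) ⌋)
    ≡⟨ countBelow-reindex v inj bounded (λ j → ⌊ ev v j ℤ.<? withAbs v j ⌋) ⟩
  countY v ∎
  where open ≡-Reasoning

abs≡suc : ∀ x k → ∣ x ∣ ≡ suc k → x ≡ + suc k ⊎ x ≡ -[1+ k ]
abs≡suc (+ _)      k refl = inj₁ refl
abs≡suc -[1+ _ ]   k refl = inj₂ refl

withAbs-single : ∀ {m} (v : Vec ℤ m) → AbsInjective v → ∀ k → k ℕ.< m →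
                 at v k ≡ - (+ suc k) → withAbs v (suc k) ≡ at v k
withAbs-single v inj k k<m π≡-k = subst (λ j → withAbs v j ≡ at v k) (cong ∣_∣ π≡-k) (withAbs-at v inj k k<m)

single-forced : ∀ {m} (v : Vec ℤ m) → AbsBounded m v → NoFixedPoint v → ∀ k → k ℕ.< m →
                withAbs v (suc k) ≡ at v k → at v k ≡ - (+ suc k)
single-forced v bounded nfp k k<m u≡π with withAbs-abs v (suc k)
... | inj₂ u≡0 = ⊥-elim (ℕP.<-irrefl refl (subst (λ t → 1 ℕ.≤ ∣ t ∣) (trans (sym u≡π) u≡0) (proj₁ (bounded k k<m))))
... | inj₁ ∣u∣≡k+1 with abs≡suc (at v k) k (trans (cong ∣_∣ (sym u≡π)) ∣u∣≡k+1)
...   | inj₁ π≡k+1  = ⊥-elim (nfp k k<m π≡k+1)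
...   | inj₂ π≡-k   = π≡-k

data LabelAt {m} (v : Vec ℤ m) (k : ℕ) : Set where
  labelledX : labelX v k ≡ true  → labelY v k ≡ false → labelZ v k ≡ false → LabelAt v k
  labelledY : labelX v k ≡ false → labelY v k ≡ true  → labelZ v k ≡ false → LabelAt v k
  labelledZ : labelX v k ≡ false → labelY v k ≡ false → labelZ v k ≡ true  → LabelAt v k

labelAt : ∀ {m} (v : Vec ℤ m) → AbsInjective v → AbsBounded m v → NoFixedPoint v → ∀ k → k ℕ.< m → LabelAt v k
labelAt v inj bounded nfp k k<m with ℤP.<-cmp (withAbs v (suc k)) (at v k)
... | tri< u<π _ _ =
  labelledX (⌊⌋≡true (_ ℤ.<? _) u<π) (⌊⌋≡false (_ ℤ.<? _) (ℤP.<-asym u<π))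
            (⌊⌋≡false (_ ℤ.≟ _) (λ π≡-k → ℤP.<-irrefl (withAbs-single v inj k k<m π≡-k) u<π))
... | tri> _ _ π<u =
  labelledY (⌊⌋≡false (_ ℤ.<? _) (ℤP.<-asym π<u)) (⌊⌋≡true (_ ℤ.<? _) π<u)
            (⌊⌋≡false (_ ℤ.≟ _) (λ π≡-k → ℤP.<-irrefl (sym (withAbs-single v inj k k<m π≡-k)) π<u))
... | tri≈ _ u≡π _ =
  labelledZ (⌊⌋≡false (_ ℤ.<? _) (ℤP.<-irrefl u≡π)) (⌊⌋≡false (_ ℤ.<? _) (ℤP.<-irrefl (sym u≡π)))
            (⌊⌋≡true (_ ℤ.≟ _) (single-forced v bounded nfp k k<m u≡π))

-- Inserting n + 1 into a signed permutation of [n]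

stats≡counts : ∀ {m} (v : Vec ℤ m) → AbsInjective v → AbsBounded m v → stats v ≡ (countX v , countY v , countZ v)
stats≡counts v inj bounded =
  cong₂ _,_ (wexc≡countX v inj bounded) (cong₂ _,_ (aexc≡countY v inj bounded) (single≡countZ v))

insertedStats : ∀ {m} {v : Vec ℤ m} {k} → LabelAt v k → Monomial → Monomial
insertedStats (labelledX _ _ _) t = timesY t
insertedStats (labelledY _ _ _) t = timesX t
insertedStats (labelledZ _ _ _) t = timesX (timesY (divZ t))

private
  +indicator-true : ∀ {b c d} → b ≡ true → c ℕ.+ indicator b ≡ d → c ≡ d ∸ 1
  +indicator-true {c = c} refl eq = trans (sym (ℕP.m+n∸n≡m c 1)) (cong (_∸ 1) eq)

  +indicator-false : ∀ {b c d} → b ≡ false → c ℕ.+ indicator b ≡ d → c ≡ d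
  +indicator-false {c = c} refl eq = trans (sym (ℕP.+-identityʳ c)) eq

-- In σ = π[k ≔ ±(n+1)] ∷ʳ p the old value at k either moves to the end
-- (p = π(k)), or, when π(k) = ±(k + 1), is replaced at the end by some p = ±(k + 1).
data Displaced {n} (π : Vec ℤ n) (k : ℕ) (p : ℤ) : Set where
  moved    : p ≡ at π k → Displaced π k p
  resigned : ∣ p ∣ ≡ suc k → ∣at∣ π k ≡ suc k → Displaced π k p

∣displaced∣ : ∀ {n} {π : Vec ℤ n} {k p} → Displaced π k p → ∣ p ∣ ≡ ∣at∣ π k
∣displaced∣ (moved p≡πk)                 = cong ∣_∣ p≡πk
∣displaced∣ (resigned ∣p∣≡k+1 ∣πk∣≡k+1) = trans ∣p∣≡k+1 (sym ∣πk∣≡k+1)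

displaced-moved : ∀ {n} {π : Vec ℤ n} {k p} → Displaced π k p → ∣at∣ π k ≢ suc k → p ≡ at π k
displaced-moved (moved p≡πk)         _         = p≡πk
displaced-moved (resigned _ ∣πk∣≡k+1) ∣πk∣≢k+1 = ⊥-elim (∣πk∣≢k+1 ∣πk∣≡k+1)

∣±[1+n]∣ : ∀ {n b} → b ≡ + suc n ⊎ b ≡ -[1+ n ] → ∣ b ∣ ≡ suc n
∣±[1+n]∣ (inj₁ refl) = refl
∣±[1+n]∣ (inj₂ refl) = refl

<+[1+n] : ∀ n x → ∣ x ∣ ℕ.≤ n → x ℤ.< + suc n
<+[1+n] n (+ a)      a≤n = ℤ.+<+ (s≤s a≤n)
<+[1+n] n -[1+ a ]   _   = ℤ.-<+

-[1+n]< : ∀ n x → ∣ x ∣ ℕ.≤ n → -[1+ n ] ℤ.< x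
-[1+n]< n (+ a)      _   = ℤ.-<+
-[1+n]< n -[1+ a ]   a<n = ℤ.-<- a<n

inRange-suc : ∀ {n x} → InRange n x → InRange (suc n) x
inRange-suc (1≤x , x≤n) = 1≤x , ℕP.m≤n⇒m≤1+n x≤n

data Position (n k : ℕ) : ℕ → Set where
  last     : Position n k n
  inserted : Position n k k
  other    : ∀ {i} → i ℕ.< n → i ≢ k → Position n k i

position : ∀ n k i → i ℕ.< suc n → Position n k i
position n k i i<1+n with i ℕ.≟ n | i ℕ.≟ k
... | yes refl | _        = last
... | no _     | yes refl = inserted
... | no i≢n   | no i≢k   = other (m<1+n∧m≢n⇒m<n i<1+n i≢n) i≢k

module Insertion {n} (π : Vec ℤ n) (bounded : AbsBounded n π)
                 (k : ℕ) (k<n : k ℕ.< n) (b : ℤ) (b≡±[1+n] : b ≡ + suc n ⊎ b ≡ -[1+ n ])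
                 (p : ℤ) (displaced : Displaced π k p) where

  σ : Vec ℤ (suc n)
  σ = update π k b ∷ʳ p

  at-σ-other : ∀ i → i ℕ.< n → i ≢ k → at σ i ≡ at π i
  at-σ-other i i<n i≢k = trans (at-∷ʳ (update π k b) p i i<n) (at-update-other π k b i i≢k)

  at-σ-k : at σ k ≡ b
  at-σ-k = trans (at-∷ʳ (update π k b) p k k<n) (at-update π k b k<n)

  at-σ-n : at σ n ≡ p
  at-σ-n = at-∷ʳ-last (update π k b) p

  ∣σ∣-other : ∀ i → i ℕ.< n → i ≢ k → ∣at∣ σ i ≡ ∣at∣ π i
  ∣σ∣-other i i<n i≢k = cong ∣_∣ (at-σ-other i i<n i≢k)

  ∣σ∣-k : ∣at∣ σ k ≡ suc n
  ∣σ∣-k = trans (cong ∣_∣ at-σ-k) (∣±[1+n]∣ b≡±[1+n])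

  ∣σ∣-n : ∣at∣ σ n ≡ ∣at∣ π k
  ∣σ∣-n = trans (cong ∣_∣ at-σ-n) (∣displaced∣ displaced)

  ∣π∣≢1+n : ∀ i → i ℕ.< n → ∣at∣ π i ≢ suc n
  ∣π∣≢1+n i i<n eq = ℕP.<-irrefl refl (subst (ℕ._≤ n) eq (proj₂ (bounded i i<n)))

  ∣p∣≤n : ∣ p ∣ ℕ.≤ n
  ∣p∣≤n = subst (ℕ._≤ n) (sym (∣displaced∣ displaced)) (proj₂ (bounded k k<n))

  σ-absBounded : AbsBounded (suc n) σ
  σ-absBounded i i<1+n with position n k i i<1+n
  ... | last          = subst (InRange (suc n)) (sym ∣σ∣-n) (inRange-suc (bounded k k<n))
  ... | inserted      = subst (InRange (suc n)) (sym ∣σ∣-k) (s≤s z≤n , ℕP.≤-refl)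
  ... | other i<n i≢k = subst (InRange (suc n)) (sym (∣σ∣-other i i<n i≢k)) (inRange-suc (bounded i i<n))

  σ-absInjective⁻ : AbsInjective σ → AbsInjective π
  σ-absInjective⁻ injσ i j i<n j<n eq with i ℕ.≟ k | j ℕ.≟ k
  ... | yes refl | yes refl = refl
  ... | no i≢k   | no j≢k   =
    injσ i j (ℕP.m<n⇒m<1+n i<n) (ℕP.m<n⇒m<1+n j<n) (trans (∣σ∣-other i i<n i≢k) (trans eq (sym (∣σ∣-other j j<n j≢k))))
  ... | yes refl | no j≢k   = ⊥-elim (ℕP.<-irrefl (sym (injσ n j (ℕP.n<1+n n) (ℕP.m<n⇒m<1+n j<n)
                                  (trans ∣σ∣-n (trans eq (sym (∣σ∣-other j j<n j≢k)))))) j<n)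
  ... | no i≢k   | yes refl = ⊥-elim (ℕP.<-irrefl (injσ i n (ℕP.m<n⇒m<1+n i<n) (ℕP.n<1+n n)
                                  (trans (∣σ∣-other i i<n i≢k) (trans eq (sym ∣σ∣-n)))) i<n)

  NoFixedPointAwayFromK : Set
  NoFixedPointAwayFromK = ∀ i → i ℕ.< n → i ≢ k → at π i ≢ + suc i

  σ-noFixedPoint⁻ : NoFixedPoint σ → NoFixedPointAwayFromK
  σ-noFixedPoint⁻ nfp i i<n i≢k fixed = nfp i (ℕP.m<n⇒m<1+n i<n) (trans (at-σ-other i i<n i≢k) fixed)

  σ-noFixedPoint : NoFixedPointAwayFromK → NoFixedPoint σ
  σ-noFixedPoint nfp i i<1+n fixed with position n k i i<1+n
  ... | last          = ℕP.<-irrefl refl (subst (ℕ._≤ n) (trans (sym (cong ∣_∣ at-σ-n)) (cong ∣_∣ fixed)) ∣p∣≤n)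
  ... | inserted      = ℕP.<-irrefl (sym (ℕP.suc-injective (trans (sym ∣σ∣-k) (cong ∣_∣ fixed)))) k<n
  ... | other i<n i≢k = nfp i i<n i≢k (trans (sym (at-σ-other i i<n i≢k)) fixed)

  module _ (inj : AbsInjective π) where

    σ-absInjective : AbsInjective σ
    σ-absInjective i j i<1+n j<1+n eq with position n k i i<1+n | position n k j j<1+n
    ... | last          | last          = refl
    ... | inserted      | inserted      = refl
    ... | other i<n i≢k | other j<n j≢k = inj i j i<n j<n (trans (sym (∣σ∣-other i i<n i≢k)) (trans eq (∣σ∣-other j j<n j≢k)))
    ... | last          | inserted      = ⊥-elim (∣π∣≢1+n k k<n (trans (sym ∣σ∣-n) (trans eq ∣σ∣-k)))
    ... | inserted      | last          = ⊥-elim (∣π∣≢1+n k k<n (trans (sym ∣σ∣-n) (trans (sym eq) ∣σ∣-k)))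
    ... | inserted      | other j<n j≢k = ⊥-elim (∣π∣≢1+n j j<n (trans (sym (∣σ∣-other j j<n j≢k)) (trans (sym eq) ∣σ∣-k)))
    ... | other i<n i≢k | inserted      = ⊥-elim (∣π∣≢1+n i i<n (trans (sym (∣σ∣-other i i<n i≢k)) (trans eq ∣σ∣-k)))
    ... | last          | other j<n j≢k =
      ⊥-elim (j≢k (sym (inj k j k<n j<n (trans (sym ∣σ∣-n) (trans eq (∣σ∣-other j j<n j≢k))))))
    ... | other i<n i≢k | last          =
      ⊥-elim (i≢k (inj i k i<n k<n (trans (sym (∣σ∣-other i i<n i≢k)) (trans eq ∣σ∣-n))))

    withAbs-σ-n : withAbs σ (suc n) ≡ b
    withAbs-σ-n =
      trans (subst (λ j → withAbs σ j ≡ at σ k) ∣σ∣-k (withAbs-at σ σ-absInjective k (ℕP.m<n⇒m<1+n k<n))) at-σ-k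

    ∣withAbs-σ-k∣≤n : ∣ withAbs σ (suc k) ∣ ℕ.≤ n
    ∣withAbs-σ-k∣≤n with withAbs-abs σ (suc k)
    ... | inj₁ ∣u∣≡k+1 = subst (ℕ._≤ n) (sym ∣u∣≡k+1) k<n
    ... | inj₂ u≡0     = subst (λ u → ∣ u ∣ ℕ.≤ n) (sym u≡0) z≤n

    withAbs-σ-other : ∀ i → i ℕ.< n → i ≢ k → withAbs σ (suc i) ≡ withAbs π (suc i)
    withAbs-σ-other i i<n i≢k with ℕP.anyUpTo? (λ l → ∣at∣ π l ℕ.≟ suc i) n
    ... | yes (l , l<n , ∣πl∣≡1+i) with l ℕ.≟ k
    ...   | yes refl = begin
      withAbs σ (suc i)   ≡⟨ subst (λ j → withAbs σ j ≡ at σ n) (trans ∣σ∣-n ∣πl∣≡1+i)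
                                   (withAbs-at σ σ-absInjective n (ℕP.n<1+n n)) ⟩
      at σ n              ≡⟨ at-σ-n ⟩
      p                   ≡⟨ displaced-moved displaced (λ ∣πk∣≡1+k → i≢k (ℕP.suc-injective (trans (sym ∣πl∣≡1+i) ∣πk∣≡1+k))) ⟩
      at π k              ≡⟨ subst (λ j → withAbs π j ≡ at π k) ∣πl∣≡1+i (withAbs-at π inj k k<n) ⟨
      withAbs π (suc i)   ∎
      where open ≡-Reasoning
    ...   | no l≢k = begin
      withAbs σ (suc i)   ≡⟨ subst (λ j → withAbs σ j ≡ at σ l) (trans (∣σ∣-other l l<n l≢k) ∣πl∣≡1+i)
                                   (withAbs-at σ σ-absInjective l (ℕP.m<n⇒m<1+n l<n)) ⟩
      at σ l              ≡⟨ at-σ-other l l<n l≢k ⟩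
      at π l              ≡⟨ subst (λ j → withAbs π j ≡ at π l) ∣πl∣≡1+i (withAbs-at π inj l l<n) ⟨
      withAbs π (suc i)   ∎
      where open ≡-Reasoning
    withAbs-σ-other i i<n i≢k | no absent =
      trans (withAbs-absent σ (suc i) absentσ) (sym (withAbs-absent π (suc i) (λ l l<n eq → absent (l , l<n , eq))))
      where
      absentσ : ∀ l → l ℕ.< suc n → ∣at∣ σ l ≢ suc i
      absentσ l l<1+n eq with position n k l l<1+n
      ... | last          = absent (k , k<n , trans (sym ∣σ∣-n) eq)
      ... | inserted      = ℕP.<-irrefl (ℕP.suc-injective (trans (sym eq) ∣σ∣-k)) i<n
      ... | other l<n l≢k = absent (l , l<n , trans (sym (∣σ∣-other l l<n l≢k)) eq)

    labelX-σ-other : ∀ i → i ℕ.< n → i ≢ k → labelX σ i ≡ labelX π i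
    labelX-σ-other i i<n i≢k = cong₂ (λ u w → ⌊ u ℤ.<? w ⌋) (withAbs-σ-other i i<n i≢k) (at-σ-other i i<n i≢k)

    labelY-σ-other : ∀ i → i ℕ.< n → i ≢ k → labelY σ i ≡ labelY π i
    labelY-σ-other i i<n i≢k = cong₂ (λ w u → ⌊ w ℤ.<? u ⌋) (at-σ-other i i<n i≢k) (withAbs-σ-other i i<n i≢k)

    labelZ-σ-other : ∀ i → i ℕ.< n → i ≢ k → labelZ σ i ≡ labelZ π i
    labelZ-σ-other i i<n i≢k = cong (λ w → ⌊ w ℤ.≟ - (+ suc i) ⌋) (at-σ-other i i<n i≢k)

    private
      count-σ : ∀ (qσ qπ : ℕ → Bool) → (∀ i → i ℕ.< n → i ≢ k → qσ i ≡ qπ i) →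
                countBelow (suc n) qσ ℕ.+ indicator (qπ k) ≡ countBelow n qπ ℕ.+ (indicator (qσ k) ℕ.+ indicator (qσ n))
      count-σ qσ qπ agree = begin
        countBelow n qσ ℕ.+ indicator (qσ n) ℕ.+ indicator (qπ k)
          ≡⟨ xy∙z≈xz∙y (countBelow n qσ) (indicator (qσ n)) (indicator (qπ k)) ⟩
        countBelow n qσ ℕ.+ indicator (qπ k) ℕ.+ indicator (qσ n)
          ≡⟨ cong (ℕ._+ indicator (qσ n)) (countBelow-update n k qπ qσ k<n (λ i i<n i≢k → sym (agree i i<n i≢k))) ⟩
        countBelow n qπ ℕ.+ indicator (qσ k) ℕ.+ indicator (qσ n)
          ≡⟨ ℕP.+-assoc (countBelow n qπ) _ _ ⟩
        countBelow n qπ ℕ.+ (indicator (qσ k) ℕ.+ indicator (qσ n)) ∎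
        where open ≡-Reasoning

      labelsX-σ : b ≡ + suc n ⊎ b ≡ -[1+ n ] → indicator (labelX σ k) ℕ.+ indicator (labelX σ n) ≡ 1
      labelsX-σ (inj₁ refl) = cong₂ (λ s t → indicator s ℕ.+ indicator t)
        (trans (cong (λ w → ⌊ withAbs σ (suc k) ℤ.<? w ⌋) at-σ-k) (⌊⌋≡true (_ ℤ.<? _) (<+[1+n] n _ ∣withAbs-σ-k∣≤n)))
        (trans (cong₂ (λ u w → ⌊ u ℤ.<? w ⌋) withAbs-σ-n at-σ-n) (⌊⌋≡false (_ ℤ.<? _) (ℤP.<-asym (<+[1+n] n p ∣p∣≤n))))
      labelsX-σ (inj₂ refl) = cong₂ (λ s t → indicator s ℕ.+ indicator t)
        (trans (cong (λ w → ⌊ withAbs σ (suc k) ℤ.<? w ⌋) at-σ-k) (⌊⌋≡false (_ ℤ.<? _) (ℤP.<-asym (-[1+n]< n _ ∣withAbs-σ-k∣≤n))))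
        (trans (cong₂ (λ u w → ⌊ u ℤ.<? w ⌋) withAbs-σ-n at-σ-n) (⌊⌋≡true (_ ℤ.<? _) (-[1+n]< n p ∣p∣≤n)))

      labelsY-σ : b ≡ + suc n ⊎ b ≡ -[1+ n ] → indicator (labelY σ k) ℕ.+ indicator (labelY σ n) ≡ 1
      labelsY-σ (inj₁ refl) = cong₂ (λ s t → indicator s ℕ.+ indicator t)
        (trans (cong (λ w → ⌊ w ℤ.<? withAbs σ (suc k) ⌋) at-σ-k) (⌊⌋≡false (_ ℤ.<? _) (ℤP.<-asym (<+[1+n] n _ ∣withAbs-σ-k∣≤n))))
        (trans (cong₂ (λ w u → ⌊ w ℤ.<? u ⌋) at-σ-n withAbs-σ-n) (⌊⌋≡true (_ ℤ.<? _) (<+[1+n] n p ∣p∣≤n)))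
      labelsY-σ (inj₂ refl) = cong₂ (λ s t → indicator s ℕ.+ indicator t)
        (trans (cong (λ w → ⌊ w ℤ.<? withAbs σ (suc k) ⌋) at-σ-k) (⌊⌋≡true (_ ℤ.<? _) (-[1+n]< n _ ∣withAbs-σ-k∣≤n)))
        (trans (cong₂ (λ w u → ⌊ w ℤ.<? u ⌋) at-σ-n withAbs-σ-n) (⌊⌋≡false (_ ℤ.<? _) (ℤP.<-asym (-[1+n]< n p ∣p∣≤n))))

      labelsZ-σ : indicator (labelZ σ k) ℕ.+ indicator (labelZ σ n) ≡ 0
      labelsZ-σ = cong₂ (λ s t → indicator s ℕ.+ indicator t)
        (⌊⌋≡false (at σ k ℤ.≟ - (+ suc k)) (λ σk≡-[1+k] → ℕP.<-irrefl (ℕP.suc-injective (trans (sym (cong ∣_∣ σk≡-[1+k])) ∣σ∣-k)) k<n))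
        (⌊⌋≡false (at σ n ℤ.≟ - (+ suc n)) (λ σn≡-[1+n] → ℕP.<-irrefl refl (subst (ℕ._≤ n) (trans (sym (cong ∣_∣ at-σ-n)) (cong ∣_∣ σn≡-[1+n])) ∣p∣≤n)))

    countX-σ : countX σ ℕ.+ indicator (labelX π k) ≡ suc (countX π)
    countX-σ = trans (count-σ (labelX σ) (labelX π) labelX-σ-other)
                     (trans (cong (countX π ℕ.+_) (labelsX-σ b≡±[1+n])) (ℕP.+-comm (countX π) 1))

    countY-σ : countY σ ℕ.+ indicator (labelY π k) ≡ suc (countY π)
    countY-σ = trans (count-σ (labelY σ) (labelY π) labelY-σ-other)
                     (trans (cong (countY π ℕ.+_) (labelsY-σ b≡±[1+n])) (ℕP.+-comm (countY π) 1))

    countZ-σ : countZ σ ℕ.+ indicator (labelZ π k) ≡ countZ π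
    countZ-σ = trans (count-σ (labelZ σ) (labelZ π) labelZ-σ-other)
                     (trans (cong (countZ π ℕ.+_) labelsZ-σ) (ℕP.+-identityʳ (countZ π)))

    stats-σ : (ℓ : LabelAt π k) → stats σ ≡ insertedStats ℓ (stats π)
    stats-σ ℓ = begin
      stats σ                                          ≡⟨ stats≡counts σ σ-absInjective σ-absBounded ⟩
      (countX σ , countY σ , countZ σ)                 ≡⟨ counts ℓ ⟩
      insertedStats ℓ (countX π , countY π , countZ π) ≡⟨ cong (insertedStats ℓ) (stats≡counts π inj bounded) ⟨
      insertedStats ℓ (stats π)                        ∎
      where
      open ≡-Reasoning
      counts : (ℓ : LabelAt π k) → (countX σ , countY σ , countZ σ) ≡ insertedStats ℓ (countX π , countY π , countZ π)
      counts (labelledX x y z) =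
        cong₂ _,_ (+indicator-true x countX-σ) (cong₂ _,_ (+indicator-false y countY-σ) (+indicator-false z countZ-σ))
      counts (labelledY x y z) =
        cong₂ _,_ (+indicator-false x countX-σ) (cong₂ _,_ (+indicator-true y countY-σ) (+indicator-false z countZ-σ))
      counts (labelledZ x y z) =
        cong₂ _,_ (+indicator-false x countX-σ) (cong₂ _,_ (+indicator-false y countY-σ) (+indicator-true z countZ-σ))

∑Words : ℕ → ∀ m → (Vec ℤ m → ℤ) → ℤ
∑Words n m F = ∑ (allVecs n m) F

∑Words-∷ : ∀ n m (F : Vec ℤ (suc m) → ℤ) →
           ∑Words n (suc m) F ≡ ∑ (signedVals n) (λ c → ∑Words n m (λ w → F (c ∷ w)))
∑Words-∷ n m F = trans (∑-concatMap (λ a → map (a ∷_) (allVecs n m)) (signedVals n) F)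
                       (∑-cong (signedVals n) (λ c → ∑-map (c ∷_) (allVecs n m) F))

∑Words-∷ʳ : ∀ n m (F : Vec ℤ (suc m) → ℤ) →
            ∑Words n (suc m) F ≡ ∑Words n m (λ w → ∑ (signedVals n) (λ a → F (w ∷ʳ a)))
∑Words-∷ʳ n zero    F = trans (∑Words-∷ n zero F) (trans (∑-cong (signedVals n) (λ c → ℤP.+-identityʳ (F (c ∷ []))))
                                                         (sym (ℤP.+-identityʳ _)))
∑Words-∷ʳ n (suc m) F = begin
  ∑Words n (suc (suc m)) F
    ≡⟨ ∑Words-∷ n (suc m) F ⟩
  ∑ (signedVals n) (λ c → ∑Words n (suc m) (λ w → F (c ∷ w)))
    ≡⟨ ∑-cong (signedVals n) (λ c → ∑Words-∷ʳ n m (λ w → F (c ∷ w))) ⟩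
  ∑ (signedVals n) (λ c → ∑Words n m (λ w → ∑ (signedVals n) (λ a → F ((c ∷ w) ∷ʳ a))))
    ≡⟨ ∑Words-∷ n m (λ w → ∑ (signedVals n) (λ a → F (w ∷ʳ a))) ⟨
  ∑Words n (suc m) (λ w → ∑ (signedVals n) (λ a → F (w ∷ʳ a))) ∎
  where open ≡-Reasoning

∑signed : ∀ n (F : ℤ → ℤ) →
          ∑ (signedVals n) F ≡ ∑ (upTo n) (λ k → F (+ suc k)) + ∑ (upTo n) (λ k → F -[1+ k ])
∑signed n F = trans (∑-++ (map (λ k → + suc k) (upTo n)) _ F)
                    (cong₂ _+_ (∑-map (λ k → + suc k) (upTo n) F) (∑-map (λ k → - (+ suc k)) (upTo n) F))

∑signed-suc : ∀ n (F : ℤ → ℤ) → ∑ (signedVals (suc n)) F ≡ ∑ (signedVals n) F + F (+ suc n) + F -[1+ n ]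
∑signed-suc n F = begin
  ∑ (signedVals (suc n)) F
    ≡⟨ ∑signed (suc n) F ⟩
  ∑ (upTo (suc n)) (λ k → F (+ suc k)) + ∑ (upTo (suc n)) (λ k → F -[1+ k ])
    ≡⟨ cong₂ _+_ (∑-upTo-suc n (λ k → F (+ suc k))) (∑-upTo-suc n (λ k → F -[1+ k ])) ⟩
  (P + F (+ suc n)) + (N + F -[1+ n ])
    ≡⟨ interchange P (F (+ suc n)) N (F -[1+ n ]) ⟩
  (P + N) + F (+ suc n) + F -[1+ n ]
    ≡⟨ cong (λ t → t + F (+ suc n) + F -[1+ n ]) (∑signed n F) ⟨
  ∑ (signedVals n) F + F (+ suc n) + F -[1+ n ] ∎
  where
  open ≡-Reasoning
  P N : ℤ
  P = ∑ (upTo n) (λ k → F (+ suc k))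
  N = ∑ (upTo n) (λ k → F -[1+ k ])
  interchange : ∀ a b c d → (a + b) + (c + d) ≡ (a + c) + b + d
  interchange = solve-∀

∑signed-cong : ∀ n {F G : ℤ → ℤ} → (∀ c → InRange n ∣ c ∣ → F c ≡ G c) →
               ∑ (signedVals n) F ≡ ∑ (signedVals n) G
∑signed-cong n {F} {G} eq = begin
  ∑ (signedVals n) F                                                   ≡⟨ ∑signed n F ⟩
  ∑ (upTo n) (λ k → F (+ suc k)) + ∑ (upTo n) (λ k → F -[1+ k ])
    ≡⟨ cong₂ _+_ (∑-upTo-cong n (λ k k<n → eq (+ suc k) (s≤s z≤n , k<n)))
                 (∑-upTo-cong n (λ k k<n → eq -[1+ k ] (s≤s z≤n , k<n))) ⟩
  ∑ (upTo n) (λ k → G (+ suc k)) + ∑ (upTo n) (λ k → G -[1+ k ])   ≡⟨ ∑signed n G ⟨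
  ∑ (signedVals n) G                                                   ∎
  where open ≡-Reasoning

absBounded-∷ : ∀ n {m} c (w : Vec ℤ m) → InRange n ∣ c ∣ → AbsBounded n w → AbsBounded n (c ∷ w)
absBounded-∷ n c w c∈ w∈ zero    _         = c∈
absBounded-∷ n c w c∈ w∈ (suc i) (s≤s i<m) = w∈ i i<m

∑Words-cong : ∀ n m {F G : Vec ℤ m → ℤ} → (∀ w → AbsBounded n w → F w ≡ G w) → ∑Words n m F ≡ ∑Words n m G
∑Words-cong n zero    eq = cong (_+ + 0) (eq [] (λ _ ()))
∑Words-cong n (suc m) {F} {G} eq = begin
  ∑Words n (suc m) F                                          ≡⟨ ∑Words-∷ n m F ⟩
  ∑ (signedVals n) (λ c → ∑Words n m (λ w → F (c ∷ w)))
    ≡⟨ ∑signed-cong n (λ c c∈ → ∑Words-cong n m (λ w w∈ → eq (c ∷ w) (absBounded-∷ n c w c∈ w∈))) ⟩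
  ∑ (signedVals n) (λ c → ∑Words n m (λ w → G (c ∷ w)))      ≡⟨ ∑Words-∷ n m G ⟨
  ∑Words n (suc m) G                                          ∎
  where open ≡-Reasoning

⌊⌋-≡ : ∀ {P Q : Set} (d : Dec P) (e : Dec Q) → (P → Q) → (Q → P) → ⌊ d ⌋ ≡ ⌊ e ⌋
⌊⌋-≡ (yes p) e p→q q→p = sym (⌊⌋≡true e (p→q p))
⌊⌋-≡ (no ¬p) e p→q q→p = sym (⌊⌋≡false e (¬p ∘ q→p))

∑-upTo-delta : ∀ N c (X : ℤ) → c ℕ.< N → ∑ (upTo N) (λ k → if ⌊ k ℕ.≟ c ⌋ then X else + 0) ≡ X
∑-upTo-delta (suc N) c X c<1+N = trans (∑-upTo-suc N _) (lastTerm (c ℕ.≟ N))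
  where
  open ≡-Reasoning
  lastTerm : Dec (c ≡ N) → ∑ (upTo N) (λ k → if ⌊ k ℕ.≟ c ⌋ then X else + 0) + (if ⌊ N ℕ.≟ c ⌋ then X else + 0) ≡ X
  lastTerm (yes refl) = begin
    ∑ (upTo c) (λ k → if ⌊ k ℕ.≟ c ⌋ then X else + 0) + (if ⌊ c ℕ.≟ c ⌋ then X else + 0)
      ≡⟨ cong₂ _+_ (trans (∑-upTo-cong c (λ k k<c → cong (λ t → if t then X else + 0) (⌊⌋≡false (k ℕ.≟ c) (ℕP.<⇒≢ k<c))))
                          (∑-zero (upTo c) (λ _ → refl)))
                   (cong (λ t → if t then X else + 0) (⌊⌋≡true (c ℕ.≟ c) refl)) ⟩
    + 0 + X
      ≡⟨ ℤP.+-identityˡ X ⟩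
    X ∎
  lastTerm (no c≢N) = begin
    ∑ (upTo N) (λ k → if ⌊ k ℕ.≟ c ⌋ then X else + 0) + (if ⌊ N ℕ.≟ c ⌋ then X else + 0)
      ≡⟨ cong₂ _+_ (∑-upTo-delta N c X (m<1+n∧m≢n⇒m<n c<1+N c≢N))
                   (cong (λ t → if t then X else + 0) (⌊⌋≡false (N ℕ.≟ c) (c≢N ∘ sym))) ⟩
    X + + 0
      ≡⟨ ℤP.+-identityʳ X ⟩
    X ∎

∑signed-delta : ∀ N c (X : ℤ) → InRange N ∣ c ∣ →
                ∑ (signedVals N) (λ a → if ⌊ a ℤ.≟ c ⌋ then X else + 0) ≡ X
∑signed-delta N (+ suc c) X (_ , c<N) = begin
  ∑ (signedVals N) (λ a → if ⌊ a ℤ.≟ + suc c ⌋ then X else + 0)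
    ≡⟨ ∑signed N _ ⟩
  ∑ (upTo N) (λ k → if ⌊ + suc k ℤ.≟ + suc c ⌋ then X else + 0) + ∑ (upTo N) (λ k → if ⌊ -[1+ k ] ℤ.≟ + suc c ⌋ then X else + 0)
    ≡⟨ cong₂ _+_ (trans (∑-cong (upTo N) (λ k → cong (λ t → if t then X else + 0)
                          (⌊⌋-≡ (+ suc k ℤ.≟ + suc c) (k ℕ.≟ c) (ℕP.suc-injective ∘ ℤP.+-injective) (cong (+_ ∘ suc)))))
                        (∑-upTo-delta N c X c<N))
                 (∑-zero (upTo N) (λ k → cong (λ t → if t then X else + 0) (⌊⌋≡false (-[1+ k ] ℤ.≟ + suc c) (λ ())))) ⟩
  X + + 0
    ≡⟨ ℤP.+-identityʳ X ⟩
  X ∎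
  where open ≡-Reasoning
∑signed-delta N -[1+ c ] X (_ , c<N) = begin
  ∑ (signedVals N) (λ a → if ⌊ a ℤ.≟ -[1+ c ] ⌋ then X else + 0)
    ≡⟨ ∑signed N _ ⟩
  ∑ (upTo N) (λ k → if ⌊ + suc k ℤ.≟ -[1+ c ] ⌋ then X else + 0) + ∑ (upTo N) (λ k → if ⌊ -[1+ k ] ℤ.≟ -[1+ c ] ⌋ then X else + 0)
    ≡⟨ cong₂ _+_ (∑-zero (upTo N) (λ k → cong (λ t → if t then X else + 0) (⌊⌋≡false (+ suc k ℤ.≟ -[1+ c ]) (λ ()))))
                 (trans (∑-cong (upTo N) (λ k → cong (λ t → if t then X else + 0)
                          (⌊⌋-≡ (-[1+ k ] ℤ.≟ -[1+ c ]) (k ℕ.≟ c) ℤP.-[1+-injective (cong -[1+_]))))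
                        (∑-upTo-delta N c X c<N)) ⟩
  + 0 + X
    ≡⟨ ℤP.+-identityˡ X ⟩
  X ∎
  where open ≡-Reasoning

HasAbs : ℕ → ∀ {m} → Vec ℤ m → Set
HasAbs N {m} w = ∃[ i ] (i ℕ.< m × ∣at∣ w i ≡ N)

HasAbsTwice : ℕ → ∀ {m} → Vec ℤ m → Set
HasAbsTwice N {m} w = ∃[ i ] ∃[ j ] (i ℕ.< m × j ℕ.< m × i ≢ j × ∣at∣ w i ≡ N × ∣at∣ w j ≡ N)

∑Words-avoiding : ∀ n m (H : Vec ℤ m → ℤ) → (∀ w → HasAbs (suc n) w → H w ≡ + 0) →
                  ∑Words (suc n) m H ≡ ∑Words n m H
∑Words-avoiding n zero    H vanish = refl
∑Words-avoiding n (suc m) H vanish = begin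
  ∑Words (suc n) (suc m) H                                    ≡⟨ ∑Words-∷ (suc n) m H ⟩
  ∑ (signedVals (suc n)) G                                    ≡⟨ ∑signed-suc n G ⟩
  ∑ (signedVals n) G + G (+ suc n) + G -[1+ n ]
    ≡⟨ cong₂ _+_ (cong₂ _+_ (∑-cong (signedVals n) (λ c → ∑Words-avoiding n m (λ w → H (c ∷ w)) (vanish-∷ c)))
                            (∑-zero (allVecs (suc n) m) (λ w → vanish (+ suc n ∷ w) (0 , z<s , refl))))
                 (∑-zero (allVecs (suc n) m) (λ w → vanish (-[1+ n ] ∷ w) (0 , z<s , refl))) ⟩
  ∑ (signedVals n) (λ c → ∑Words n m (λ w → H (c ∷ w))) + + 0 + + 0
    ≡⟨ trans (ℤP.+-identityʳ _) (ℤP.+-identityʳ _) ⟩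
  ∑ (signedVals n) (λ c → ∑Words n m (λ w → H (c ∷ w)))       ≡⟨ ∑Words-∷ n m H ⟨
  ∑Words n (suc m) H                                          ∎
  where
  open ≡-Reasoning
  G : ℤ → ℤ
  G c = ∑Words (suc n) m (λ w → H (c ∷ w))
  vanish-∷ : ∀ c w → HasAbs (suc n) w → H (c ∷ w) ≡ + 0
  vanish-∷ c w (i , i<m , ∣wi∣≡1+n) = vanish (c ∷ w) (suc i , s≤s i<m , ∣wi∣≡1+n)

±[1+_] : ℕ → List ℤ
±[1+ n ] = + suc n ∷ -[1+ n ] ∷ []

-- A word w over ±[n + 1] whose only entry ±(n + 1) is b, at position k, followed by a letter
-- a ∈ ±[n], is π[k ≔ b] followed by π(k) for the word π = w[k ≔ a] over ±[n].
∑Words-once : ∀ n m (H : Vec ℤ m → ℤ → ℤ) → (∀ w a → HasAbsTwice (suc n) w → H w a ≡ + 0) →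
  ∑Words (suc n) m (λ w → ∑ (signedVals n) (H w)) ≡
  ∑Words n m (λ w → ∑ (signedVals n) (H w)) +
  ∑Words n m (λ π → ∑ (upTo m) (λ k → ∑ ±[1+ n ] (λ b → H (update π k b) (at π k))))
∑Words-once n zero    H vanish = sym (ℤP.+-identityʳ _)
∑Words-once n (suc m) H vanish = begin
  ∑Words (suc n) (suc m) (λ w → ∑ (signedVals n) (H w))        ≡⟨ ∑Words-∷ (suc n) m _ ⟩
  ∑ (signedVals (suc n)) G                                      ≡⟨ ∑signed-suc n G ⟩
  ∑ (signedVals n) G + G (+ suc n) + G -[1+ n ]
    ≡⟨ cong₂ _+_ (cong₂ _+_ (∑-cong (signedVals n) G≡P+Q) (G≡T (+ suc n) refl)) (G≡T -[1+ n ] refl) ⟩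
  ∑ (signedVals n) (λ c → P c + Q c) + T (+ suc n) + T -[1+ n ]
    ≡⟨ cong (λ t → t + T (+ suc n) + T -[1+ n ]) (∑-+ (signedVals n) P Q) ⟩
  ∑ (signedVals n) P + ∑ (signedVals n) Q + T (+ suc n) + T -[1+ n ]
    ≡⟨ rearrange (∑ (signedVals n) P) (∑ (signedVals n) Q) (T (+ suc n)) (T -[1+ n ]) ⟩
  ∑ (signedVals n) P + ((T (+ suc n) + (T -[1+ n ] + + 0)) + ∑ (signedVals n) Q)
    ≡⟨ cong (λ t → ∑ (signedVals n) P + (t + ∑ (signedVals n) Q)) ∑R≡∑T ⟨
  ∑ (signedVals n) P + (∑ (signedVals n) R + ∑ (signedVals n) Q)
    ≡⟨ cong₂ _+_ (∑Words-∷ n m (λ w → ∑ (signedVals n) (H w))) (trans (sym ∑R+Q) (∑-+ (signedVals n) R Q)) ⟨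
  ∑Words n (suc m) (λ w → ∑ (signedVals n) (H w)) +
  ∑Words n (suc m) (λ π → ∑ (upTo (suc m)) (λ k → ∑ ±[1+ n ] (λ b → H (update π k b) (at π k)))) ∎
  where
  open ≡-Reasoning
  G P Q T R : ℤ → ℤ
  G c = ∑Words (suc n) m (λ w → ∑ (signedVals n) (H (c ∷ w)))
  P c = ∑Words n m (λ w → ∑ (signedVals n) (H (c ∷ w)))
  Q c = ∑Words n m (λ π → ∑ (upTo m) (λ k → ∑ ±[1+ n ] (λ b → H (c ∷ update π k b) (at π k))))
  T b = ∑Words n m (λ w → ∑ (signedVals n) (H (b ∷ w)))
  R c = ∑Words n m (λ π → ∑ ±[1+ n ] (λ b → H (b ∷ π) c))

  G≡P+Q : ∀ c → G c ≡ P c + Q c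
  G≡P+Q c = ∑Words-once n m (λ w a → H (c ∷ w) a)
    (λ w a (i , j , i<m , j<m , i≢j , ∣wi∣ , ∣wj∣) →
       vanish (c ∷ w) a (suc i , suc j , s≤s i<m , s≤s j<m , i≢j ∘ ℕP.suc-injective , ∣wi∣ , ∣wj∣))

  G≡T : ∀ b → ∣ b ∣ ≡ suc n → G b ≡ T b
  G≡T b ∣b∣ = ∑Words-avoiding n m _ (λ w (i , i<m , ∣wi∣) →
    ∑-zero (signedVals n) (λ a → vanish (b ∷ w) a (0 , suc i , z<s , s≤s i<m , (λ ()) , ∣b∣ , ∣wi∣)))

  rearrange : ∀ p q a b → p + q + a + b ≡ p + ((a + (b + + 0)) + q)
  rearrange = solve-∀

  ∑R≡∑T : ∑ (signedVals n) R ≡ T (+ suc n) + (T -[1+ n ] + + 0)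
  ∑R≡∑T = begin
    ∑ (signedVals n) (λ c → ∑Words n m (λ π → ∑ ±[1+ n ] (λ b → H (b ∷ π) c)))
      ≡⟨ ∑-cong (signedVals n) (λ c → ∑-swap (allVecs n m) ±[1+ n ] (λ π b → H (b ∷ π) c)) ⟩
    ∑ (signedVals n) (λ c → ∑ ±[1+ n ] (λ b → ∑Words n m (λ π → H (b ∷ π) c)))
      ≡⟨ ∑-swap (signedVals n) ±[1+ n ] (λ c b → ∑Words n m (λ π → H (b ∷ π) c)) ⟩
    ∑ ±[1+ n ] (λ b → ∑ (signedVals n) (λ c → ∑Words n m (λ π → H (b ∷ π) c)))
      ≡⟨ ∑-cong ±[1+ n ] (λ b → ∑-swap (signedVals n) (allVecs n m) (λ c π → H (b ∷ π) c)) ⟩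
    ∑ ±[1+ n ] T ∎

  ∑R+Q : ∑ (signedVals n) (λ c → R c + Q c) ≡
         ∑Words n (suc m) (λ π → ∑ (upTo (suc m)) (λ k → ∑ ±[1+ n ] (λ b → H (update π k b) (at π k))))
  ∑R+Q = begin
    ∑ (signedVals n) (λ c → R c + Q c)
      ≡⟨ ∑-cong (signedVals n) (λ c → ∑-+ (allVecs n m) _ _) ⟨
    ∑ (signedVals n) (λ c → ∑Words n m (λ π → ∑ ±[1+ n ] (λ b → H (b ∷ π) c) +
                                          ∑ (upTo m) (λ k → ∑ ±[1+ n ] (λ b → H (c ∷ update π k b) (at π k)))))
      ≡⟨ ∑-cong (signedVals n) (λ c → ∑-cong (allVecs n m) (λ π →
           ∑-upTo-suc′ m (λ k → ∑ ±[1+ n ] (λ b → H (update (c ∷ π) k b) (at (c ∷ π) k))))) ⟨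
    ∑ (signedVals n) (λ c → ∑Words n m (λ π → ∑ (upTo (suc m)) (λ k → ∑ ±[1+ n ] (λ b → H (update (c ∷ π) k b) (at (c ∷ π) k)))))
      ≡⟨ ∑Words-∷ n m _ ⟨
    ∑Words n (suc m) (λ π → ∑ (upTo (suc m)) (λ k → ∑ ±[1+ n ] (λ b → H (update π k b) (at π k)))) ∎

∑Words-exchange : ∀ n m k c d (G : Vec ℤ m → ℤ) → InRange n ∣ c ∣ → InRange n ∣ d ∣ → k ℕ.< m →
  ∑Words n m (λ π → if ⌊ at π k ℤ.≟ c ⌋ then G (update π k d) else + 0) ≡
  ∑Words n m (λ π → if ⌊ at π k ℤ.≟ d ⌋ then G (update π k d) else + 0)
∑Words-exchange n (suc m) zero c d G c∈ d∈ _ = trans (both c c∈) (sym (both d d∈))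
  where
  both : ∀ c′ → InRange n ∣ c′ ∣ →
         ∑Words n (suc m) (λ π → if ⌊ at π 0 ℤ.≟ c′ ⌋ then G (update π 0 d) else + 0) ≡ ∑Words n m (λ w → G (d ∷ w))
  both c′ c′∈ = trans (∑Words-∷ n m _) (trans (∑-cong (signedVals n) (λ a → ∑-if (allVecs n m) ⌊ a ℤ.≟ c′ ⌋ (λ w → G (d ∷ w))))
                                              (∑signed-delta n c′ _ c′∈))
∑Words-exchange n (suc m) (suc k) c d G c∈ d∈ (s≤s k<m) =
  trans (∑Words-∷ n m _)
        (trans (∑-cong (signedVals n) (λ a → ∑Words-exchange n m k c d (λ w → G (a ∷ w)) c∈ d∈ k<m))
               (sym (∑Words-∷ n m _)))

ifDerangement-∑ : ∀ {m} {A : Set} (v : Vec ℤ m) (l : List A) h → ∑ l (λ a → ifDerangement v (h a)) ≡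
                  ifDerangement v (∑ l h)
ifDerangement-∑ v l h with isDerangement v
... | true  = refl
... | false = ∑-zero l (λ _ → refl)

ifDerangement-+ : ∀ {m} (v : Vec ℤ m) r s → ifDerangement v r + ifDerangement v s ≡ ifDerangement v (r + s)
ifDerangement-+ v r s with isDerangement v
... | true  = refl
... | false = refl

ifDerangement-if : ∀ {m} (v : Vec ℤ m) (c : Bool) r →
                   (if c then ifDerangement v r else + 0) ≡ ifDerangement v (if c then r else + 0)
ifDerangement-if v true  r = refl
ifDerangement-if v false r with isDerangement v
... | true  = refl
... | false = refl

ifDerangement-cong : ∀ {m} (v : Vec ℤ m) {r r′} → (isDerangement v ≡ true → r ≡ r′) → ifDerangement v r ≡
                     ifDerangement v r′
ifDerangement-cong v eq with isDerangement v
... | true  = eq refl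
... | false = refl

isDerangement⁻ : ∀ {m} (v : Vec ℤ m) → isDerangement v ≡ true → AbsInjective v × NoFixedPoint v
isDerangement⁻ v eq with d , f ← ∧≡true⁻ {distinctAbs v} eq =
  distinctAbs⇒absInjective v d , fixedPointFree⇒noFixedPoint v f

isDerangement-≡ : ∀ {m m′} (v : Vec ℤ m) (w : Vec ℤ m′) →
  (AbsInjective v → AbsInjective w) → (AbsInjective w → AbsInjective v) →
  (NoFixedPoint v → NoFixedPoint w) → (NoFixedPoint w → NoFixedPoint v) → isDerangement v ≡ isDerangement w
isDerangement-≡ v w injᵛʷ injʷᵛ nfpᵛʷ nfpʷᵛ = cong₂ _∧_
  (Bool-≡ (absInjective⇒distinctAbs w ∘ injᵛʷ ∘ distinctAbs⇒absInjective v)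
          (absInjective⇒distinctAbs v ∘ injʷᵛ ∘ distinctAbs⇒absInjective w))
  (Bool-≡ (noFixedPoint⇒fixedPointFree w ∘ nfpᵛʷ ∘ fixedPointFree⇒noFixedPoint v)
          (noFixedPoint⇒fixedPointFree v ∘ nfpʷᵛ ∘ fixedPointFree⇒noFixedPoint w))

ifDerangement-notInjective : ∀ {m} (v : Vec ℤ m) r → ¬ AbsInjective v → ifDerangement v r ≡ + 0
ifDerangement-notInjective v r ¬inj with isDerangement v in eq
... | true  = ⊥-elim (¬inj (proj₁ (isDerangement⁻ v eq)))
... | false = refl

ifDerangement-fixedPoint : ∀ {m} (v : Vec ℤ m) r → ∀ i → i ℕ.< m → at v i ≡ + suc i → ifDerangement v r ≡ + 0
ifDerangement-fixedPoint v r i i<m fixed with isDerangement v in eq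
... | true  = ⊥-elim (proj₂ (isDerangement⁻ v eq) i i<m fixed)
... | false = refl

derangementSum : ℕ → (Monomial → ℤ) → ℤ
derangementSum n f = ∑ (DB n) (f ∘ stats)

derangementSum≡∑Words : ∀ n f → derangementSum n f ≡ ∑Words n n (λ v → ifDerangement v (f (stats v)))
derangementSum≡∑Words n f =
  trans (∑-filter fixedPointFree (Bn n) (f ∘ stats))
        (trans (∑-filter distinctAbs (allVecs n n) (λ v → if fixedPointFree v then f (stats v) else + 0))
               (∑-cong (allVecs n n) if-∧))
  where
  if-∧ : ∀ v → (if distinctAbs v then (if fixedPointFree v then f (stats v) else + 0) else + 0) ≡
         ifDerangement v (f (stats v))
  if-∧ v with distinctAbs v
  ... | true  = refl
  ... | false = refl

absInjective-cong : ∀ {m} (v w : Vec ℤ m) → (∀ i → i ℕ.< m → ∣at∣ v i ≡ ∣at∣ w i) →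
                    AbsInjective v → AbsInjective w
absInjective-cong v w eq inj i j i<m j<m ∣wi∣≡∣wj∣ =
  inj i j i<m j<m (trans (eq i i<m) (trans ∣wi∣≡∣wj∣ (sym (eq j j<m))))

ifDerangement-insert : ∀ {n} (π : Vec ℤ n) → AbsBounded n π → ∀ k → k ℕ.< n →
  ∀ b → b ≡ + suc n ⊎ b ≡ -[1+ n ] → ∀ r →
  ifDerangement (update π k b ∷ʳ at π k) r ≡
  ifDerangement π r + (if ⌊ at π k ℤ.≟ + suc k ⌋ then ifDerangement (update π k -[1+ k ]) r else + 0)
ifDerangement-insert {n} π bounded k k<n b b≡± r with at π k ℤ.≟ + suc k
... | no πk≢1+k = trans (cong (λ d → if d then r else + 0) σ≡π) (sym (ℤP.+-identityʳ _))
  where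
  open Insertion π bounded k k<n b b≡± (at π k) (moved refl)
  σ≡π : isDerangement σ ≡ isDerangement π
  σ≡π = isDerangement-≡ σ π σ-absInjective⁻ σ-absInjective
    (λ nfp i i<n → case i ℕ.≟ k of λ where
       (yes refl) → πk≢1+k
       (no i≢k)   → σ-noFixedPoint⁻ nfp i i<n i≢k)
    (λ nfp → σ-noFixedPoint (λ i i<n _ → nfp i i<n))
... | yes πk≡1+k = begin
  ifDerangement σ r                 ≡⟨ cong (λ d → if d then r else + 0) σ≡π′ ⟩
  ifDerangement π′ r                ≡⟨ ℤP.+-identityˡ _ ⟨
  + 0 + ifDerangement π′ r          ≡⟨ cong (_+ ifDerangement π′ r) (ifDerangement-fixedPoint π r k k<n πk≡1+k) ⟨
  ifDerangement π r + ifDerangement π′ r ∎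
  where
  open ≡-Reasoning
  open Insertion π bounded k k<n b b≡± (at π k) (moved refl)
  π′ : Vec ℤ n
  π′ = update π k -[1+ k ]
  at-π′ : ∀ i → i ≢ k → at π′ i ≡ at π i
  at-π′ i = at-update-other π k -[1+ k ] i
  ∣π∣≡∣π′∣ : ∀ i → i ℕ.< n → ∣at∣ π i ≡ ∣at∣ π′ i
  ∣π∣≡∣π′∣ i i<n with i ℕ.≟ k
  ... | yes refl = trans (cong ∣_∣ πk≡1+k) (sym (cong ∣_∣ (at-update π k -[1+ k ] k<n)))
  ... | no i≢k   = sym (cong ∣_∣ (at-π′ i i≢k))
  σ≡π′ : isDerangement σ ≡ isDerangement π′
  σ≡π′ = isDerangement-≡ σ π′
    (absInjective-cong π π′ ∣π∣≡∣π′∣ ∘ σ-absInjective⁻)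
    (σ-absInjective ∘ absInjective-cong π′ π (λ i i<n → sym (∣π∣≡∣π′∣ i i<n)))
    (λ nfp i i<n → case i ℕ.≟ k of λ where
       (yes refl) → λ π′k≡1+k → case trans (sym (at-update π k -[1+ k ] k<n)) π′k≡1+k of λ ()
       (no i≢k)   → σ-noFixedPoint⁻ nfp i i<n i≢k ∘ trans (sym (at-π′ i i≢k)))
    (λ nfp → σ-noFixedPoint (λ i i<n i≢k → nfp i i<n ∘ trans (at-π′ i i≢k)))

ifDerangement-∷ʳ-twice : ∀ {m} N (w : Vec ℤ m) a r → HasAbsTwice N w → ifDerangement (w ∷ʳ a) r ≡ + 0
ifDerangement-∷ʳ-twice N w a r (i , j , i<m , j<m , i≢j , ∣wi∣ , ∣wj∣) =
  ifDerangement-notInjective (w ∷ʳ a) r λ inj →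
    i≢j (inj i j (ℕP.m<n⇒m<1+n i<m) (ℕP.m<n⇒m<1+n j<m)
             (trans (cong ∣_∣ (at-∷ʳ w a i i<m)) (trans ∣wi∣ (trans (sym ∣wj∣) (sym (cong ∣_∣ (at-∷ʳ w a j j<m)))))))

ifDerangement-∷ʳ-repeated : ∀ {n} (w : Vec ℤ n) r → HasAbs (suc n) w → ifDerangement (w ∷ʳ -[1+ n ]) r ≡ + 0
ifDerangement-∷ʳ-repeated {n} w r (i , i<n , ∣wi∣) =
  ifDerangement-notInjective (w ∷ʳ -[1+ n ]) r λ inj →
    ℕP.<-irrefl (inj i n (ℕP.m<n⇒m<1+n i<n) (ℕP.n<1+n n)
                      (trans (cong ∣_∣ (at-∷ʳ w _ i i<n)) (trans ∣wi∣ (sym (cong ∣_∣ (at-∷ʳ-last w -[1+ n ])))))) i<n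

ifDerangement-∷ʳ-fixed : ∀ {n} (w : Vec ℤ n) r → ifDerangement (w ∷ʳ + suc n) r ≡ + 0
ifDerangement-∷ʳ-fixed {n} w r = ifDerangement-fixedPoint (w ∷ʳ + suc n) r n (ℕP.n<1+n n) (at-∷ʳ-last w (+ suc n))

absBounded-∷ʳ : ∀ {n m} (w : Vec ℤ m) a → AbsBounded n w → InRange n ∣ a ∣ → AbsBounded n (w ∷ʳ a)
absBounded-∷ʳ {m = m} w a w∈ a∈ i i<1+m with i ℕ.≟ m
... | yes refl = subst (InRange _) (sym (cong ∣_∣ (at-∷ʳ-last w a))) a∈
... | no i≢m   = subst (InRange _) (sym (cong ∣_∣ (at-∷ʳ w a i i<m))) (w∈ i i<m)
  where
  i<m : i ℕ.< m
  i<m = m<1+n∧m≢n⇒m<n i<1+m i≢m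

ifDerangement-∷ʳ-small : ∀ {n} (w : Vec ℤ n) a r → AbsBounded n w → InRange n ∣ a ∣ →
                         ifDerangement (w ∷ʳ a) r ≡ + 0
ifDerangement-∷ʳ-small {n} w a r w∈ a∈ =
  ifDerangement-notInjective (w ∷ʳ a) r λ inj →
    ℕP.<-irrefl refl (absInjective⇒length≤ n (w ∷ʳ a) inj (absBounded-∷ʳ w a w∈ a∈))

module AppendSingle {n} (w : Vec ℤ n) (bounded : AbsBounded n w) where

  σ : Vec ℤ (suc n)
  σ = w ∷ʳ -[1+ n ]

  ∣w∣≢1+n : ∀ i → i ℕ.< n → ∣at∣ w i ≢ suc n
  ∣w∣≢1+n i i<n eq = ℕP.<-irrefl refl (subst (ℕ._≤ n) eq (proj₂ (bounded i i<n)))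

  at-σ : ∀ i → i ℕ.< n → at σ i ≡ at w i
  at-σ i = at-∷ʳ w _ i

  ∣σ∣ : ∀ i → i ℕ.< n → ∣at∣ σ i ≡ ∣at∣ w i
  ∣σ∣ i i<n = cong ∣_∣ (at-σ i i<n)

  ∣σ∣-last : ∣at∣ σ n ≡ suc n
  ∣σ∣-last = cong ∣_∣ (at-∷ʳ-last w -[1+ n ])

  isDerangement-σ : isDerangement σ ≡ isDerangement w
  isDerangement-σ = isDerangement-≡ σ w injσ⇒injw injw⇒injσ
    (λ nfp i i<n → nfp i (ℕP.m<n⇒m<1+n i<n) ∘ trans (at-∷ʳ w _ i i<n))
    (λ nfp i i<1+n fixed → case i ℕ.≟ n of λ where
       (yes refl) → case trans (sym (at-∷ʳ-last w -[1+ n ])) fixed of λ ()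
       (no i≢n)   → let i<n = m<1+n∧m≢n⇒m<n i<1+n i≢n in nfp i i<n (trans (sym (at-∷ʳ w _ i i<n)) fixed))
    where
    injσ⇒injw : AbsInjective σ → AbsInjective w
    injσ⇒injw inj i j i<n j<n eq = inj i j (ℕP.m<n⇒m<1+n i<n) (ℕP.m<n⇒m<1+n j<n)
      (trans (cong ∣_∣ (at-∷ʳ w _ i i<n)) (trans eq (sym (cong ∣_∣ (at-∷ʳ w _ j j<n)))))
    injw⇒injσ : AbsInjective w → AbsInjective σ
    injw⇒injσ inj i j i<1+n j<1+n eq with i ℕ.≟ n | j ℕ.≟ n
    ... | yes refl | yes refl = refl
    ... | no i≢n   | no j≢n   = let i<n = m<1+n∧m≢n⇒m<n i<1+n i≢n; j<n = m<1+n∧m≢n⇒m<n j<1+n j≢n in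
      inj i j i<n j<n (trans (sym (∣σ∣ i i<n)) (trans eq (∣σ∣ j j<n)))
    ... | yes refl | no j≢n   = let j<n = m<1+n∧m≢n⇒m<n j<1+n j≢n in
      ⊥-elim (∣w∣≢1+n j j<n (trans (sym (∣σ∣ j j<n)) (trans (sym eq) ∣σ∣-last)))
    ... | no i≢n   | yes refl = let i<n = m<1+n∧m≢n⇒m<n i<1+n i≢n in
      ⊥-elim (∣w∣≢1+n i i<n (trans (sym (∣σ∣ i i<n)) (trans eq ∣σ∣-last)))

  ev-σ-∣at∣ : ∀ i → i ℕ.< n → ev σ (∣at∣ σ i) ≡ ev w (∣at∣ w i)
  ev-σ-∣at∣ i i<n = trans (cong (ev σ) (∣σ∣ i i<n)) (ev-∷ʳ w _ (∣at∣ w i) (proj₂ (bounded i i<n)))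

  wexc-σ : wexc σ ≡ wexc w
  wexc-σ = begin
    wexc σ
      ≡⟨ wexc≡countBelow σ ⟩
    countBelow n (λ i → ⌊ at σ i ℤ.<? ev σ (∣at∣ σ i) ⌋) ℕ.+ indicator ⌊ at σ n ℤ.<? ev σ (∣at∣ σ n) ⌋
      ≡⟨ cong₂ (λ c t → c ℕ.+ indicator t)
               (countBelow-cong n (λ i i<n → cong₂ (λ u v → ⌊ u ℤ.<? v ⌋) (at-σ i i<n) (ev-σ-∣at∣ i i<n)))
               (⌊⌋≡false (_ ℤ.<? _) (ℤP.<-irrefl (sym (cong (ev σ) ∣σ∣-last)))) ⟩
    countBelow n (λ i → ⌊ at w i ℤ.<? ev w (∣at∣ w i) ⌋) ℕ.+ 0
      ≡⟨ ℕP.+-identityʳ _ ⟩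
    countBelow n (λ i → ⌊ at w i ℤ.<? ev w (∣at∣ w i) ⌋)
      ≡⟨ wexc≡countBelow w ⟨
    wexc w ∎
    where open ≡-Reasoning

  aexc-σ : aexc σ ≡ aexc w
  aexc-σ = begin
    aexc σ
      ≡⟨ aexc≡countBelow σ ⟩
    countBelow n (λ i → ⌊ ev σ (∣at∣ σ i) ℤ.<? at σ i ⌋) ℕ.+ indicator ⌊ ev σ (∣at∣ σ n) ℤ.<? at σ n ⌋
      ≡⟨ cong₂ (λ c t → c ℕ.+ indicator t)
               (countBelow-cong n (λ i i<n → cong₂ (λ v u → ⌊ v ℤ.<? u ⌋) (ev-σ-∣at∣ i i<n) (at-σ i i<n)))
               (⌊⌋≡false (_ ℤ.<? _) (ℤP.<-irrefl (cong (ev σ) ∣σ∣-last))) ⟩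
    countBelow n (λ i → ⌊ ev w (∣at∣ w i) ℤ.<? at w i ⌋) ℕ.+ 0
      ≡⟨ ℕP.+-identityʳ _ ⟩
    countBelow n (λ i → ⌊ ev w (∣at∣ w i) ℤ.<? at w i ⌋)
      ≡⟨ aexc≡countBelow w ⟨
    aexc w ∎
    where open ≡-Reasoning

  single-σ : single σ ≡ suc (single w)
  single-σ = begin
    single σ
      ≡⟨ single≡countZ σ ⟩
    countBelow n (labelZ σ) ℕ.+ indicator (labelZ σ n)
      ≡⟨ cong₂ (λ c t → c ℕ.+ indicator t)
               (countBelow-cong n (λ i i<n → cong (λ u → ⌊ u ℤ.≟ - (+ suc i) ⌋) (at-σ i i<n)))
               (⌊⌋≡true (_ ℤ.≟ _) (at-∷ʳ-last w -[1+ n ])) ⟩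
    countZ w ℕ.+ 1
      ≡⟨ ℕP.+-comm _ 1 ⟩
    suc (countZ w)
      ≡⟨ cong suc (single≡countZ w) ⟨
    suc (single w) ∎
    where open ≡-Reasoning

  ifDerangement-σ : ∀ (f : Monomial → ℤ) → ifDerangement σ (f (stats σ)) ≡ ifDerangement w (f (timesZ (stats w)))
  ifDerangement-σ f = cong₂ (λ d t → if d then f t else + 0) isDerangement-σ
                            (cong₂ _,_ wexc-σ (cong₂ _,_ aexc-σ single-σ))

-- The recurrence for derangements

∑±[1+n]-const : ∀ n (F : ℤ → ℤ) c → (∀ b → b ≡ + suc n ⊎ b ≡ -[1+ n ] → F b ≡ c) →
                ∑ ±[1+ n ] F ≡ + 2 * c
∑±[1+n]-const n F c eq = trans (cong₂ (λ u v → u + (v + + 0)) (eq (+ suc n) (inj₁ refl)) (eq -[1+ n ] (inj₂ refl)))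
                               (double c)
  where
  double : ∀ c → c + (c + + 0) ≡ + 2 * c
  double = solve-∀

∑±[1+n]-cong : ∀ n {F G : ℤ → ℤ} → (∀ b → b ≡ + suc n ⊎ b ≡ -[1+ n ] → F b ≡ G b) →
               ∑ ±[1+ n ] F ≡ ∑ ±[1+ n ] G
∑±[1+n]-cong n eq = cong₂ (λ u v → u + (v + + 0)) (eq (+ suc n) (inj₁ refl)) (eq -[1+ n ] (inj₂ refl))

insertedStats-split : ∀ {m} {v : Vec ℤ m} {k} (ℓ : LabelAt v k) (g : Monomial → ℤ) t →
  g (insertedStats ℓ t) ≡ (if labelX v k then g (timesY t) else + 0) + (if labelY v k then g (timesX t) else + 0)
                          + (if labelZ v k then g (timesX (timesY (divZ t))) else + 0)
insertedStats-split (labelledX x y z) g t rewrite x | y | z = sym (trans (ℤP.+-identityʳ _) (ℤP.+-identityʳ _))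
insertedStats-split (labelledY x y z) g t rewrite x | y | z = sym (trans (ℤP.+-identityʳ _) (ℤP.+-identityˡ _))
insertedStats-split (labelledZ x y z) g t rewrite x | y | z = sym (ℤP.+-identityˡ _)

insertionTerm resignationTerm : ∀ {n} → (Monomial → ℤ) → Vec ℤ n → ℤ
insertionTerm f π = + wexc π * (+ 2 * f (timesY (stats π))) + + aexc π * (+ 2 * f (timesX (stats π)))
                    + + single π * (+ 2 * f (timesX (timesY (divZ (stats π)))))
resignationTerm f π = + single π * (+ 2 * f (timesX (timesY (divZ (stats π)))))

module _ {n} (f : Monomial → ℤ) (π : Vec ℤ n) (bounded : AbsBounded n π) (isDer : isDerangement π ≡ true) where

  private
    inj : AbsInjective π
    inj = proj₁ (isDerangement⁻ π isDer)

    label : ∀ k → k ℕ.< n → LabelAt π k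
    label = labelAt π inj bounded (proj₂ (isDerangement⁻ π isDer))

    t : Monomial
    t = stats π

  insertion-sum : ∑ (upTo n) (λ k → ∑ ±[1+ n ] (λ b → f (stats (update π k b ∷ʳ at π k)))) ≡ insertionTerm f π
  insertion-sum = begin
    ∑ (upTo n) (λ k → ∑ ±[1+ n ] (λ b → f (stats (update π k b ∷ʳ at π k))))
      ≡⟨ ∑-upTo-cong n per-position ⟩
    ∑ (upTo n) (λ k → X k + Y k + Z k)
      ≡⟨ trans (∑-+ (upTo n) _ Z) (cong (_+ ∑ (upTo n) Z) (∑-+ (upTo n) X Y)) ⟩
    ∑ (upTo n) X + ∑ (upTo n) Y + ∑ (upTo n) Z
      ≡⟨ cong₂ _+_ (cong₂ _+_ (∑-indicator n (labelX π) _) (∑-indicator n (labelY π) _)) (∑-indicator n (labelZ π) _) ⟩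
    + countX π * (+ 2 * f (timesY t)) + + countY π * (+ 2 * f (timesX t)) + + countZ π * (+ 2 * f (timesX (timesY (divZ t))))
      ≡⟨ cong₂ _+_ (cong₂ _+_ (cong (λ c → + c * (+ 2 * f (timesY t))) (wexc≡countX π inj bounded))
                              (cong (λ c → + c * (+ 2 * f (timesX t))) (aexc≡countY π inj bounded)))
                   (cong (λ c → + c * (+ 2 * f (timesX (timesY (divZ t))))) (single≡countZ π)) ⟨
    + wexc π * (+ 2 * f (timesY t)) + + aexc π * (+ 2 * f (timesX t)) + + single π * (+ 2 * f (timesX (timesY (divZ t)))) ∎
    where
    open ≡-Reasoning
    X Y Z : ℕ → ℤ
    X k = if labelX π k then + 2 * f (timesY t) else + 0
    Y k = if labelY π k then + 2 * f (timesX t) else + 0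
    Z k = if labelZ π k then + 2 * f (timesX (timesY (divZ t))) else + 0
    per-position : ∀ k → k ℕ.< n → ∑ ±[1+ n ] (λ b → f (stats (update π k b ∷ʳ at π k))) ≡ X k + Y k + Z k
    per-position k k<n =
      trans (∑±[1+n]-const n _ (f (insertedStats (label k k<n) t))
               (λ b b≡± → cong f (Insertion.stats-σ π bounded k k<n b b≡± (at π k) (moved refl) inj (label k k<n))))
            (insertedStats-split (label k k<n) (λ s → + 2 * f s) t)

  resign-sum : ∑ (upTo n) (λ k → if labelZ π k then ∑ ±[1+ n ] (λ b → f (stats (update π k b ∷ʳ + suc k))) else + 0) ≡
               resignationTerm f π
  resign-sum = begin
    ∑ (upTo n) (λ k → if labelZ π k then ∑ ±[1+ n ] (λ b → f (stats (update π k b ∷ʳ + suc k))) else + 0)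
      ≡⟨ ∑-upTo-cong n (λ k k<n → if-cong (labelZ π k) (per-position k k<n)) ⟩
    ∑ (upTo n) (λ k → if labelZ π k then + 2 * f (timesX (timesY (divZ t))) else + 0)
      ≡⟨ ∑-indicator n (labelZ π) _ ⟩
    + countZ π * (+ 2 * f (timesX (timesY (divZ t))))
      ≡⟨ cong (λ c → + c * (+ 2 * f (timesX (timesY (divZ t))))) (single≡countZ π) ⟨
    + single π * (+ 2 * f (timesX (timesY (divZ t)))) ∎
    where
    open ≡-Reasoning
    if-cong : ∀ c {x y : ℤ} → (c ≡ true → x ≡ y) → (if c then x else + 0) ≡ (if c then y else + 0)
    if-cong true  eq = eq refl
    if-cong false eq = refl
    per-position : ∀ k → k ℕ.< n → labelZ π k ≡ true →
                   ∑ ±[1+ n ] (λ b → f (stats (update π k b ∷ʳ + suc k))) ≡ + 2 * f (timesX (timesY (divZ t)))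
    per-position k k<n z with label k k<n
    ... | labelledX _ _ z′ = case trans (sym z) z′ of λ ()
    ... | labelledY _ _ z′ = case trans (sym z) z′ of λ ()
    ... | ℓ@(labelledZ _ _ _) =
      ∑±[1+n]-const n _ _ (λ b b≡± → cong f (Insertion.stats-σ π bounded k k<n b b≡± (+ suc k)
        (resigned refl (cong ∣_∣ (⌊⌋≡true⁻ (at π k ℤ.≟ - (+ suc k)) z))) inj ℓ))

module _ (n : ℕ) (f : Monomial → ℤ) where

  open ≡-Reasoning

  private
    V : ∀ {m} → Vec ℤ m → ℤ
    V σ = ifDerangement σ (f (stats σ))

    resigned-sum : ℕ → Vec ℤ n → ℤ
    resigned-sum k π = ∑ ±[1+ n ] (λ b → ifDerangement π (f (stats (update π k b ∷ʳ + suc k))))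

  ∑Words-resignations :
    ∑Words n n (λ π → ∑ (upTo n) (λ k → if ⌊ at π k ℤ.≟ + suc k ⌋ then resigned-sum k (update π k -[1+ k ]) else + 0)) ≡
    ∑Words n n (λ π → ifDerangement π (resignationTerm f π))
  ∑Words-resignations = begin
    ∑Words n n (λ π → ∑ (upTo n) (λ k → if ⌊ at π k ℤ.≟ + suc k ⌋ then resigned-sum k (update π k -[1+ k ]) else + 0))
      ≡⟨ ∑-swap (allVecs n n) (upTo n) _ ⟩
    ∑ (upTo n) (λ k → ∑Words n n (λ π → if ⌊ at π k ℤ.≟ + suc k ⌋ then resigned-sum k (update π k -[1+ k ]) else + 0))
      ≡⟨ ∑-upTo-cong n (λ k k<n → trans (∑Words-exchange n n k (+ suc k) -[1+ k ] (resigned-sum k) (s≤s z≤n , k<n) (s≤s z≤n , k<n) k<n)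
                                         (∑-cong (allVecs n n) (λ π → exchanged k k<n π))) ⟩
    ∑ (upTo n) (λ k → ∑Words n n (λ π → if labelZ π k then resigned-sum k π else + 0))
      ≡⟨ ∑-swap (allVecs n n) (upTo n) _ ⟨
    ∑Words n n (λ π → ∑ (upTo n) (λ k → if labelZ π k then resigned-sum k π else + 0))
      ≡⟨ ∑Words-cong n n (λ π bounded → pull-out π bounded) ⟩
    ∑Words n n (λ π → ifDerangement π (resignationTerm f π)) ∎
    where
    exchanged : ∀ k → k ℕ.< n → ∀ π →
                (if ⌊ at π k ℤ.≟ -[1+ k ] ⌋ then resigned-sum k (update π k -[1+ k ]) else + 0) ≡
                (if labelZ π k then resigned-sum k π else + 0)
    exchanged k k<n π with at π k ℤ.≟ -[1+ k ]
    ... | yes πk≡-[1+k] = cong (resigned-sum k) (trans (cong (update π k) (sym πk≡-[1+k])) (update-at π k k<n))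
    ... | no _          = refl
    pull-out : ∀ π → AbsBounded n π →
               ∑ (upTo n) (λ k → if labelZ π k then resigned-sum k π else + 0) ≡ ifDerangement π (resignationTerm f π)
    pull-out π bounded = begin
      ∑ (upTo n) (λ k → if labelZ π k then resigned-sum k π else + 0)
        ≡⟨ ∑-cong (upTo n) (λ k → trans (cong (λ r → if labelZ π k then r else + 0) (ifDerangement-∑ π ±[1+ n ] (F k)))
                                        (ifDerangement-if π (labelZ π k) (∑ ±[1+ n ] (F k)))) ⟩
      ∑ (upTo n) (λ k → ifDerangement π (if labelZ π k then ∑ ±[1+ n ] (λ b → f (stats (update π k b ∷ʳ + suc k))) else + 0))
        ≡⟨ ifDerangement-∑ π (upTo n) _ ⟩
      ifDerangement π (∑ (upTo n) (λ k → if labelZ π k then ∑ ±[1+ n ] (λ b → f (stats (update π k b ∷ʳ + suc k))) else + 0))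
        ≡⟨ ifDerangement-cong π (resign-sum f π bounded) ⟩
      ifDerangement π (resignationTerm f π) ∎
      where
      F : ℕ → ℤ → ℤ
      F k b = f (stats (update π k b ∷ʳ + suc k))

  ∑Words-insertions :
    ∑Words n n (λ π → ∑ (upTo n) (λ k → ∑ ±[1+ n ] (λ b → V (update π k b ∷ʳ at π k)))) ≡
    ∑Words n n (λ π → ifDerangement π (insertionTerm f π)) + ∑Words n n (λ π → ifDerangement π (resignationTerm f π))
  ∑Words-insertions = begin
    ∑Words n n (λ π → ∑ (upTo n) (λ k → ∑ ±[1+ n ] (λ b → V (update π k b ∷ʳ at π k))))
      ≡⟨ ∑Words-cong n n split ⟩
    ∑Words n n (λ π → ifDerangement π (insertionTerm f π) + R π)
      ≡⟨ ∑-+ (allVecs n n) _ R ⟩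
    ∑Words n n (λ π → ifDerangement π (insertionTerm f π)) + ∑Words n n R
      ≡⟨ cong (_+_ (∑Words n n (λ π → ifDerangement π (insertionTerm f π)))) ∑Words-resignations ⟩
    ∑Words n n (λ π → ifDerangement π (insertionTerm f π)) + ∑Words n n (λ π → ifDerangement π (resignationTerm f π)) ∎
    where
    R : Vec ℤ n → ℤ
    R π = ∑ (upTo n) (λ k → if ⌊ at π k ℤ.≟ + suc k ⌋ then resigned-sum k (update π k -[1+ k ]) else + 0)

    split : ∀ π → AbsBounded n π → ∑ (upTo n) (λ k → ∑ ±[1+ n ] (λ b → V (update π k b ∷ʳ at π k))) ≡
                                  ifDerangement π (insertionTerm f π) + R π
    split π bounded = begin
      ∑ (upTo n) (λ k → ∑ ±[1+ n ] (λ b → V (update π k b ∷ʳ at π k)))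
        ≡⟨ ∑-upTo-cong n (λ k k<n → ∑±[1+n]-cong n (λ b b≡± → ifDerangement-insert π bounded k k<n b b≡± (f (stats (update π k b ∷ʳ at π k))))) ⟩
      ∑ (upTo n) (λ k → ∑ ±[1+ n ] (λ b → kept k b + (if c k then resigning k b else + 0)))
        ≡⟨ ∑-cong (upTo n) (λ k → ∑-+ ±[1+ n ] (kept k) (λ b → if c k then resigning k b else + 0)) ⟩
      ∑ (upTo n) (λ k → ∑ ±[1+ n ] (kept k) + ∑ ±[1+ n ] (λ b → if c k then resigning k b else + 0))
        ≡⟨ ∑-+ (upTo n) _ _ ⟩
      ∑ (upTo n) (λ k → ∑ ±[1+ n ] (kept k)) + ∑ (upTo n) (λ k → ∑ ±[1+ n ] (λ b → if c k then resigning k b else + 0))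
        ≡⟨ cong₂ _+_ keptPart resignedPart ⟩
      ifDerangement π (insertionTerm f π) + R π ∎
      where
      c : ℕ → Bool
      c k = ⌊ at π k ℤ.≟ + suc k ⌋
      kept resigning : ℕ → ℤ → ℤ
      kept k b = ifDerangement π (f (stats (update π k b ∷ʳ at π k)))
      resigning k b = ifDerangement (update π k -[1+ k ]) (f (stats (update π k b ∷ʳ at π k)))

      keptPart : ∑ (upTo n) (λ k → ∑ ±[1+ n ] (kept k)) ≡ ifDerangement π (insertionTerm f π)
      keptPart = begin
        ∑ (upTo n) (λ k → ∑ ±[1+ n ] (kept k))
          ≡⟨ ∑-cong (upTo n) (λ k → ifDerangement-∑ π ±[1+ n ] (λ b → f (stats (update π k b ∷ʳ at π k)))) ⟩
        ∑ (upTo n) (λ k → ifDerangement π (∑ ±[1+ n ] (λ b → f (stats (update π k b ∷ʳ at π k)))))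
          ≡⟨ ifDerangement-∑ π (upTo n) _ ⟩
        ifDerangement π (∑ (upTo n) (λ k → ∑ ±[1+ n ] (λ b → f (stats (update π k b ∷ʳ at π k)))))
          ≡⟨ ifDerangement-cong π (insertion-sum f π bounded) ⟩
        ifDerangement π (insertionTerm f π) ∎

      resignedPart : ∑ (upTo n) (λ k → ∑ ±[1+ n ] (λ b → if c k then resigning k b else + 0)) ≡ R π
      resignedPart = ∑-cong (upTo n) λ k → trans (∑-if ±[1+ n ] (c k) (resigning k)) (resignedₖ k (at π k ℤ.≟ + suc k))
        where
        resignedₖ : ∀ k (d : Dec (at π k ≡ + suc k)) →
                    (if ⌊ d ⌋ then ∑ ±[1+ n ] (resigning k) else + 0) ≡ (if ⌊ d ⌋ then resigned-sum k (update π k -[1+ k ]) else + 0)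
        resignedₖ k (yes πk≡1+k) = ∑-cong ±[1+ n ] (λ b →
          cong (λ σ → ifDerangement (update π k -[1+ k ]) (f (stats σ)))
               (cong₂ _∷ʳ_ (sym (update-update π k b -[1+ k ])) πk≡1+k))
        resignedₖ k (no _)       = refl

  ∑Words-appendSingle : ∑Words (suc n) n (λ w → V (w ∷ʳ -[1+ n ])) ≡
                        ∑Words n n (λ w → ifDerangement w (f (timesZ (stats w))))
  ∑Words-appendSingle =
    trans (∑Words-avoiding n n _ (λ w hasAbs → ifDerangement-∷ʳ-repeated w _ hasAbs))
          (∑Words-cong n n (λ w bounded → AppendSingle.ifDerangement-σ w bounded f))

  ∑Words-oldLetters : ∑Words (suc n) n (λ w → ∑ (signedVals n) (λ a → V (w ∷ʳ a))) ≡
                      ∑Words n n (λ π → ifDerangement π (insertionTerm f π)) + ∑Words n n (λ π → ifDerangement π (resignationTerm f π))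
  ∑Words-oldLetters = begin
    ∑Words (suc n) n (λ w → ∑ (signedVals n) (λ a → V (w ∷ʳ a)))
      ≡⟨ ∑Words-once n n (λ w a → V (w ∷ʳ a)) (λ w a twice → ifDerangement-∷ʳ-twice (suc n) w a _ twice) ⟩
    ∑Words n n (λ w → ∑ (signedVals n) (λ a → V (w ∷ʳ a))) + ∑Words n n insertions
      ≡⟨ cong (_+ ∑Words n n insertions)
              (trans (∑Words-cong n n (λ w bounded → ∑signed-cong n (λ a a∈ → ifDerangement-∷ʳ-small w a _ bounded a∈)))
                     (∑-zero (allVecs n n) (λ w → ∑-zero (signedVals n) (λ _ → refl)))) ⟩
    + 0 + ∑Words n n insertions
      ≡⟨ ℤP.+-identityˡ _ ⟩
    ∑Words n n insertions
      ≡⟨ ∑Words-insertions ⟩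
    ∑Words n n (λ π → ifDerangement π (insertionTerm f π)) + ∑Words n n (λ π → ifDerangement π (resignationTerm f π)) ∎
    where
    insertions : Vec ℤ n → ℤ
    insertions π = ∑ (upTo n) (λ k → ∑ ±[1+ n ] (λ b → V (update π k b ∷ʳ at π k)))

  private
    withLast : Vec ℤ n → ℤ → ℤ
    withLast w a = V (w ∷ʳ a)

    insertions resignations singles : ℤ
    insertions   = ∑Words n n (λ π → ifDerangement π (insertionTerm f π))
    resignations = ∑Words n n (λ π → ifDerangement π (resignationTerm f π))
    singles      = ∑Words n n (λ π → ifDerangement π (f (timesZ (stats π))))

  derangementSum-withLast :
    derangementSum (suc n) f ≡ ∑Words (suc n) n (λ w → ∑ (signedVals n) (withLast w))
                               + ∑Words (suc n) n (λ w → V (w ∷ʳ + suc n)) + ∑Words (suc n) n (λ w → V (w ∷ʳ -[1+ n ]))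
  derangementSum-withLast = begin
    derangementSum (suc n) f
      ≡⟨ derangementSum≡∑Words (suc n) f ⟩
    ∑Words (suc n) (suc n) V
      ≡⟨ ∑Words-∷ʳ (suc n) n V ⟩
    ∑Words (suc n) n (λ w → ∑ (signedVals (suc n)) (withLast w))
      ≡⟨ ∑-cong (allVecs (suc n) n) (λ w → ∑signed-suc n (withLast w)) ⟩
    ∑Words (suc n) n (λ w → ∑ (signedVals n) (withLast w) + V (w ∷ʳ + suc n) + V (w ∷ʳ -[1+ n ]))
      ≡⟨ trans (∑-+ (allVecs (suc n) n) _ _) (cong (_+ ∑Words (suc n) n (λ w → V (w ∷ʳ -[1+ n ]))) (∑-+ (allVecs (suc n) n) _ _)) ⟩
    ∑Words (suc n) n (λ w → ∑ (signedVals n) (withLast w))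
    + ∑Words (suc n) n (λ w → V (w ∷ʳ + suc n)) + ∑Words (suc n) n (λ w → V (w ∷ʳ -[1+ n ])) ∎

  insertions+resignations+singles : insertions + resignations + singles ≡ derangementSum n (Tᵀ f)
  insertions+resignations+singles = begin
    insertions + resignations + singles
      ≡⟨ trans (∑-+ (allVecs n n) _ _) (cong (_+ singles) (∑-+ (allVecs n n) _ _)) ⟨
    ∑Words n n (λ π → ifDerangement π (insertionTerm f π) + ifDerangement π (resignationTerm f π)
                      + ifDerangement π (f (timesZ (stats π))))
      ≡⟨ ∑-cong (allVecs n n) collect ⟩
    ∑Words n n (λ π → ifDerangement π (Tᵀ f (stats π)))
      ≡⟨ derangementSum≡∑Words n (Tᵀ f) ⟨
    derangementSum n (Tᵀ f) ∎
    where
    collect : ∀ π → ifDerangement π (insertionTerm f π) + ifDerangement π (resignationTerm f π)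
                    + ifDerangement π (f (timesZ (stats π))) ≡ ifDerangement π (Tᵀ f (stats π))
    collect π = trans (cong (_+ ifDerangement π (f (timesZ (stats π)))) (ifDerangement-+ π _ _))
      (trans (ifDerangement-+ π _ _) (cong (ifDerangement π)
        (rearrange (+ wexc π) (+ aexc π) (+ single π) (f (timesY (stats π))) (f (timesX (stats π)))
                   (f (timesX (timesY (divZ (stats π))))) (f (timesZ (stats π))))))
      where
      rearrange : ∀ a b c Fy Fx Fxy Fz →
        (a * (+ 2 * Fy) + b * (+ 2 * Fx) + c * (+ 2 * Fxy)) + c * (+ 2 * Fxy) + Fz ≡
        Fz + (+ 2 * a) * Fy + (+ 2 * b) * Fx + (+ 4 * c) * Fxy
      rearrange = solve-∀

  derangementSum-Tᵀ : derangementSum (suc n) f ≡ derangementSum n (Tᵀ f)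
  derangementSum-Tᵀ = begin
    derangementSum (suc n) f
      ≡⟨ derangementSum-withLast ⟩
    ∑Words (suc n) n (λ w → ∑ (signedVals n) (withLast w))
    + ∑Words (suc n) n (λ w → V (w ∷ʳ + suc n)) + ∑Words (suc n) n (λ w → V (w ∷ʳ -[1+ n ]))
      ≡⟨ cong₂ _+_ (cong₂ _+_ ∑Words-oldLetters (∑-zero (allVecs (suc n) n) (λ w → ifDerangement-∷ʳ-fixed w _)))
                   ∑Words-appendSingle ⟩
    insertions + resignations + + 0 + singles
      ≡⟨ cong (_+ singles) (ℤP.+-identityʳ (insertions + resignations)) ⟩
    insertions + resignations + singles
      ≡⟨ insertions+resignations+singles ⟩
    derangementSum n (Tᵀ f) ∎

derangementSum≡gammaSum : ∀ k f → derangementSum (suc k) f ≡ gammaSum (suc k) (suc (suc k)) f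
derangementSum≡gammaSum zero    f =
  trans (derangementSum-Tᵀ 0 f) (only-g₁₀ (f (0 , 0 , 1)) (f (0 , 1 , 0)) (f (1 , 0 , 0)) (f (1 , 1 , 0)) (f (1 , 1 , 1)))
  where
  only-g₁₀ : ∀ a b c d e → a + + 0 * b + + 0 * c + + 0 * d + + 0 ≡
             (+ 0 * (c + b) + (+ 0 * d + + 0)) + ((+ 1 * a) + (+ 0 * e + + 0) + + 0)
  only-g₁₀ = solve-∀
derangementSum≡gammaSum (suc k) f = begin
  derangementSum (suc (suc k)) f              ≡⟨ derangementSum-Tᵀ (suc k) f ⟩
  derangementSum (suc k) (Tᵀ f)               ≡⟨ derangementSum≡gammaSum k (Tᵀ f) ⟩
  gammaSum (suc k) (2 ℕ.+ k) (Tᵀ f)           ≡⟨ gammaSum-truncate k (Tᵀ f) (ℕP.n≤1+n _) ⟨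
  gammaSum (suc k) (3 ℕ.+ k) (Tᵀ f)           ≡⟨ gammaSum-Tᵀ k f ⟨
  gammaSum (suc (suc k)) (3 ℕ.+ k) f          ∎
  where open ≡-Reasoning

theorem4 : (n : ℕ) → n ≥ 1 →
    ((i j : ℤ) → + 0 ≤ g n i j) × ((x y z : ℤ) → E n x y z ≡ gammaExpansion n x y z)
theorem4 (suc k) _ = gaux-nonneg k , λ x y z → begin
  E (suc k) x y z                                ≡⟨⟩
  derangementSum (suc k) (evalAt x y z)          ≡⟨ derangementSum≡gammaSum k (evalAt x y z) ⟩
  gammaSum (suc k) (suc (suc k)) (evalAt x y z)  ≡⟨ gammaExpansion≡gammaSum k x y z ⟨
  gammaExpansion (suc k) x y z                   ∎
  where open ≡-Reasoning
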